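{- Let $q=(1+uy)/(1+y)$. For $n\ge1$ let $s_n(u,y)=\sum_D u^{\operatorname{des}(D)}y^{e(D)}$, the sum over all strongly connected digraphs $D$ on $[n]$. Define $\eta_n(u,y)$ for $n\ge1$ recursively by \[\eta_n(u,y)=(1+y)^{\binom n2}(1+uy)^{\binom n2}-\sum_{k=1}^{n-1}\binom nk_q(1+uy)^{\binom{n-k}2}(1+y)^{(n-k)(n+k-1)/2}\eta_k(u,y).\] Then for all $n\ge1$, \[s_n(u,y)=\eta_n(u,y)+\sum_{k=1}^{n-1}\binom{n-1}{k-1}s_k(u,y)\,\eta_{n-k}(u,y).\]
   Context: A digraph on a finite set $V$ of integers is a set $E\subseteq V\times V$ of ordered pairs $(s,t)$ with $s\neq t$ (its edges); $e(D)$ is the number of edges. A descent is an edge $(s,t)$ with $s>t$; $\operatorname{des}(D)$ is the number of descents. A digraph is strongly connected if for every two vertices $a,b$ there is a directed path from $a$ to $b$ (the empty path allowed when $a=b$). $n!_q=\prod_{k=1}^n(1+q+\cdots+q^{k-1})$ and $\binom nk_q=\frac{n!_q}{k!_q(n-k)!_q}$. -}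

module Defs where

open import Data.Nat as ℕ using (ℕ; zero; suc; _∸_; _<_; _>_)
open import Data.Nat.Combinatorics using (_C_)
open import Data.Nat.DivMod using (_/_)
open import Data.Fin using (Fin; toℕ)
open import Data.Vec using (Vec; lookup)
open import Data.Bool using (Bool; true; false)
open import Data.List using (List; []; _∷_; map; allFin)
open import Data.Nat.ListAction using (sum)
open import Relation.Nullary using (yes; no)
open import Data.Integer using (+_)
open import Data.Rational as ℚ using (ℚ; 0ℚ; 1ℚ; _+_; _-_; _*_; _÷_; ≢-nonZero)
open import Data.Product using (_×_; Σ)
open import Relation.Binary.PropositionalEquality using (_≡_; _≢_)

ℕtoℚ : ℕ → ℚ
ℕtoℚ n = (+ n) ℚ./ 1

infixr 8 _^_
_^_ : ℚ → ℕ → ℚ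
x ^ zero = 1ℚ
x ^ suc n = x * (x ^ n)

sumℚ : List ℚ → ℚ
sumℚ [] = 0ℚ
sumℚ (x ∷ xs) = x + sumℚ xs

countℕ : List Bool → ℕ
countℕ [] = 0
countℕ (true ∷ bs) = suc (countℕ bs)
countℕ (false ∷ bs) = countℕ bs

-- Σ_{k=a}^{b} f k  (empty if b < a)
range : ℕ → ℕ → List ℕ
range a b = go (suc b ∸ a) a
  where
  go : ℕ → ℕ → List ℕ
  go zero i = []
  go (suc m) i = i ∷ go m (suc i)

Σ[_⋯_] : ℕ → ℕ → (ℕ → ℚ) → ℚ
Σ[ a ⋯ b ] f = sumℚ (map f (range a b))

-- Gaussian (q-)binomial coefficient [n choose k]_q, evaluated at q ∈ ℚ,
-- via the q-Pascal rule  [n+1,k+1] = [n,k] + q^(k+1) [n,k+1]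
-- (this is the polynomial n!_q / (k!_q (n-k)!_q) in q).

qbinom : ℚ → ℕ → ℕ → ℚ
qbinom q n zero = 1ℚ
qbinom q zero (suc k) = 0ℚ
qbinom q (suc n) (suc k) = qbinom q n k + (q ^ suc k) * qbinom q n (suc k)

-- Digraphs on [n] = Fin n, given by adjacency matrices:
-- (s,t) is an edge iff lookup (lookup M s) t ≡ true.

Digraph : ℕ → Set
Digraph n = Vec (Vec Bool n) n

edge : ∀ {n} → Digraph n → Fin n → Fin n → Bool
edge M s t = lookup (lookup M s) t

Loopless : ∀ {n} → Digraph n → Set
Loopless {n} M = (s : Fin n) → edge M s s ≡ false

data Path {n} (M : Digraph n) (a : Fin n) : Fin n → Set where
  here : Path M a a
  step : ∀ {b c} → Path M a b → edge M b c ≡ true → Path M a c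

StronglyConnected : ∀ {n} → Digraph n → Set
StronglyConnected {n} M = (a b : Fin n) → Path M a b

e : ∀ {n} → Digraph n → ℕ
e {n} M = sum (map (λ s → countℕ (map (λ t → edge M s t) (allFin n))) (allFin n))

isDescent : ∀ {n} → Digraph n → Fin n → Fin n → Bool
isDescent M s t with toℕ t ℕ.<? toℕ s
... | yes _ = edge M s t
... | no _ = false

des : ∀ {n} → Digraph n → ℕ
des {n} M = sum (map (λ s → countℕ (map (λ t → isDescent M s t) (allFin n))) (allFin n))

-- s_n(u,y) = Σ_D u^des(D) y^e(D), where the sum ranges over a
-- duplicate-free list enumerating the strongly connected digraphs on [n].

weightSum : ∀ {n} → ℚ → ℚ → List (Digraph n) → ℚ
weightSum u y L = sumℚ (map (λ D → (u ^ des D) * (y ^ e D)) L)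

qval : (u y : ℚ) → (1ℚ + y) ≢ 0ℚ → ℚ
qval u y nz = _÷_ (1ℚ + u * y) (1ℚ + y) {{≢-nonZero nz}}

-- η_n(u,y), defined by recursion on n (with a fuel argument f ≥ n):
-- η_n = (1+y)^C(n,2) (1+uy)^C(n,2)
--       - Σ_{k=1}^{n-1} [n,k]_q (1+uy)^C(n-k,2) (1+y)^((n-k)(n+k-1)/2) η_k
etaF : (u y : ℚ) → (1ℚ + y) ≢ 0ℚ → ℕ → ℕ → ℚ
etaF u y nz zero n = 0ℚ
etaF u y nz (suc f) n =
  ((1ℚ + y) ^ (n C 2)) * ((1ℚ + u * y) ^ (n C 2))
  - Σ[ 1 ⋯ n ∸ 1 ] (λ k →
      qbinom (qval u y nz) n k
      * ((1ℚ + u * y) ^ ((n ∸ k) C 2))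
      * ((1ℚ + y) ^ (((n ∸ k) ℕ.* (n ℕ.+ k ∸ 1)) / 2))
      * etaF u y nz f k)

eta : (u y : ℚ) → (1ℚ + y) ≢ 0ℚ → ℕ → ℚ
eta u y nz n = etaF u y nz n n

-- For a digraph D and a vertex set S let η_D(S) be (−1)^(k+1) when S induces a disjoint union of
-- k strongly connected pieces with no edges between them, and 0 otherwise; put
-- etaSum n = Σ_D η_D([n]) u^des(D) y^e(D), the sum over all loopless digraphs on [n].
-- First, toggling a source component is a sign-reversing involution showing Σ_A η_D(A) = 0, the sum
-- over the in-closed vertex sets A of D. Summing over D and cutting each D into the subgraphs induced
-- on A and on its complement, the edges between them only leaving A, every term factors; the sizes
-- of the A contribute Gaussian binomials in q, and the identity becomes the recursion defining η_n.
-- Hence etaSum n = η_n. Second, expanding η_D([n]) along the detached strongly connected piece that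
-- contains vertex 0 expresses etaSum n through the s_j, which rearranges to the corollary.
module Submission where

open import Defs
open import Data.Nat as ℕ using (ℕ; zero; suc; _≤_; _<_; _≥_; _∸_; z≤n; s≤s; _≡ᵇ_)
import Data.Nat.Properties as ℕₚ
open import Data.Nat.DivMod using (_/_; m*n/n≡m)
open import Data.Nat.Solver using () renaming (module +-*-Solver to ℕ-Solver)
open import Data.Nat.Combinatorics using (_C_; nCk+nC[k+1]≡[n+1]C[k+1]; nC1≡n; nCn≡1)
open import Data.Fin using (Fin; zero; suc; toℕ)
import Data.Fin.Properties as Finₚ
open import Data.Bool as Bool using (Bool; true; false; _∧_; _∨_; not; if_then_else_)
import Data.Bool.Properties as Boolₚ
open import Data.Vec as Vec using (Vec; []; _∷_; lookup; replicate; zipWith)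
import Data.Vec.Properties as Vecₚ
open import Data.Maybe as Maybe using (Maybe; just; nothing; maybe)
import Data.Maybe.Properties as Maybeₚ
open import Data.List as List using (List; []; _∷_; map; _++_; allFin; filter; cartesianProductWith)
open import Data.List.Membership.Propositional using (_∈_; lose)
open import Data.List.Membership.Propositional.Properties
  using (∈-map⁺; ∈-map⁻; ∈-++⁺ˡ; ∈-++⁺ʳ; ∈-allFin; ∈-filter⁺; ∈-filter⁻; ∈-cartesianProductWith⁺; ∈-cartesianProduct⁺)
open import Data.List.Membership.Propositional.Properties.WithK using (unique∧set⇒bag)
open import Data.List.Relation.Unary.Any as Any using (here; there)
import Data.List.Relation.Unary.All as All
open All using ([]; _∷_)
open import Data.List.Relation.Unary.AllPairs using ([]; _∷_)
open import Data.List.Relation.Unary.Unique.Propositional using (Unique)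
import Data.List.Relation.Unary.Unique.Propositional.Properties as Uniqueₚ
open import Data.List.Relation.Binary.Permutation.Propositional as ↭ using (_↭_)
open import Data.List.Relation.Binary.BagAndSetEquality using (∼bag⇒↭)
import Data.Integer as ℤ
import Data.Integer.Properties as ℤₚ
import Data.Nat.Coprimality as Coprime
open import Data.Rational as ℚ using (ℚ; 0ℚ; 1ℚ; _+_; _*_; -_; _-_)
open import Data.Rational.Properties
open import Data.Rational.Solver using (module +-*-Solver)
open import Data.Unit using (tt)
open import Data.Nat.ListAction using (sum)
open import Data.Product using (Σ; ∃; _×_; _,_; proj₁; proj₂)
open import Data.Sum as Sum using (_⊎_; inj₁; inj₂)
open import Data.Empty using (⊥; ⊥-elim)
open import Function using (_∘_; id; case_of_)
open import Function.Bundles using (_⇔_; mk⇔; Equivalence)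
import Function.Properties.Equivalence
open import Relation.Nullary using (¬_; ¬?; Dec; does; yes; no; _×-dec_; _→-dec_)
open import Relation.Nullary.Decidable using (map′; dec-true; does-⇔)
open import Relation.Unary using (Decidable)
open import Relation.Binary.Definitions using (Tri; tri<; tri≈; tri>)
open import Relation.Binary.PropositionalEquality
open ≡-Reasoning

χ : Bool → ℚ
χ true = 1ℚ
χ false = 0ℚ

∑ : ∀ {a} {A : Set a} → List A → (A → ℚ) → ℚ
∑ [] f = 0ℚ
∑ (x ∷ xs) f = f x + ∑ xs f

∏ : ∀ {a} {A : Set a} → List A → (A → ℚ) → ℚ
∏ [] f = 1ℚ
∏ (x ∷ xs) f = f x * ∏ xs f

unique-↭ : ∀ {a} {A : Set a} {xs ys : List A} → Unique xs → Unique ys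
  → (∀ {x} → x ∈ xs → x ∈ ys) → (∀ {x} → x ∈ ys → x ∈ xs) → xs ↭ ys
unique-↭ ux uy to from = ∼bag⇒↭ (unique∧set⇒bag ux uy (mk⇔ to from))

module _ {a} {A : Set a} where

  sumℚ-map : (L : List A) (f : A → ℚ) → sumℚ (map f L) ≡ ∑ L f
  sumℚ-map [] f = refl
  sumℚ-map (x ∷ L) f = cong (f x +_) (sumℚ-map L f)

  ∑-++ : (L M : List A) (f : A → ℚ) → ∑ (L ++ M) f ≡ ∑ L f + ∑ M f
  ∑-++ [] M f = sym (+-identityˡ _)
  ∑-++ (x ∷ L) M f = trans (cong (f x +_) (∑-++ L M f)) (sym (+-assoc (f x) _ _))

  ∏-++ : (L M : List A) (f : A → ℚ) → ∏ (L ++ M) f ≡ ∏ L f * ∏ M f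
  ∏-++ [] M f = sym (*-identityˡ _)
  ∏-++ (x ∷ L) M f = trans (cong (f x *_) (∏-++ L M f)) (sym (*-assoc (f x) _ _))

  ∑-cong-∈ : (L : List A) {f g : A → ℚ} → (∀ {x} → x ∈ L → f x ≡ g x) → ∑ L f ≡ ∑ L g
  ∑-cong-∈ [] h = refl
  ∑-cong-∈ (x ∷ L) h = cong₂ _+_ (h (here refl)) (∑-cong-∈ L (h ∘ there))

  ∑-cong : (L : List A) {f g : A → ℚ} → (∀ x → f x ≡ g x) → ∑ L f ≡ ∑ L g
  ∑-cong L h = ∑-cong-∈ L (λ {x} _ → h x)

  ∏-cong : (L : List A) {f g : A → ℚ} → (∀ x → f x ≡ g x) → ∏ L f ≡ ∏ L g
  ∏-cong [] h = refl
  ∏-cong (x ∷ L) h = cong₂ _*_ (h x) (∏-cong L h)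

  ∑-zero : (L : List A) → ∑ L (λ _ → 0ℚ) ≡ 0ℚ
  ∑-zero [] = refl
  ∑-zero (x ∷ L) = trans (+-identityˡ _) (∑-zero L)

  ∑-distrib-+ : (L : List A) (f g : A → ℚ) → ∑ L (λ x → f x + g x) ≡ ∑ L f + ∑ L g
  ∑-distrib-+ [] f g = refl
  ∑-distrib-+ (x ∷ L) f g = trans (cong (f x + g x +_) (∑-distrib-+ L f g))
    (solve 4 (λ a b c d → (a :+ b) :+ (c :+ d) := (a :+ c) :+ (b :+ d)) refl (f x) (g x) (∑ L f) (∑ L g))
    where open +-*-Solver

  ∏-distrib-* : (L : List A) (f g : A → ℚ) → ∏ L (λ x → f x * g x) ≡ ∏ L f * ∏ L g
  ∏-distrib-* [] f g = refl
  ∏-distrib-* (x ∷ L) f g = trans (cong (f x * g x *_) (∏-distrib-* L f g))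
    (solve 4 (λ a b c d → (a :* b) :* (c :* d) := (a :* c) :* (b :* d)) refl (f x) (g x) (∏ L f) (∏ L g))
    where open +-*-Solver

  *-distribˡ-∑ : (c : ℚ) (L : List A) (f : A → ℚ) → c * ∑ L f ≡ ∑ L (λ x → c * f x)
  *-distribˡ-∑ c [] f = *-zeroʳ c
  *-distribˡ-∑ c (x ∷ L) f = trans (*-distribˡ-+ c (f x) _) (cong (c * f x +_) (*-distribˡ-∑ c L f))

  *-distribʳ-∑ : (c : ℚ) (L : List A) (f : A → ℚ) → ∑ L f * c ≡ ∑ L (λ x → f x * c)
  *-distribʳ-∑ c L f = trans (*-comm _ c) (trans (*-distribˡ-∑ c L f) (∑-cong L (λ x → *-comm c (f x))))

  ∑-neg : (L : List A) (f : A → ℚ) → ∑ L (λ x → - f x) ≡ - ∑ L f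
  ∑-neg [] f = refl
  ∑-neg (x ∷ L) f = trans (cong (- f x +_) (∑-neg L f)) (sym (neg-distrib-+ (f x) _))

  ∑-↭ : {L M : List A} (f : A → ℚ) → L ↭ M → ∑ L f ≡ ∑ M f
  ∑-↭ f ↭.refl = refl
  ∑-↭ f (↭.prep x p) = cong (f x +_) (∑-↭ f p)
  ∑-↭ f (↭.swap {xs} {ys} x y p) = begin
    f x + (f y + ∑ xs f) ≡⟨ sym (+-assoc (f x) _ _) ⟩
    (f x + f y) + ∑ xs f ≡⟨ cong₂ _+_ (+-comm (f x) (f y)) (∑-↭ f p) ⟩
    (f y + f x) + ∑ ys f ≡⟨ +-assoc (f y) _ _ ⟩
    f y + (f x + ∑ ys f) ∎
  ∑-↭ f (↭.trans p q) = trans (∑-↭ f p) (∑-↭ f q)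

  ∏-↭ : {L M : List A} (f : A → ℚ) → L ↭ M → ∏ L f ≡ ∏ M f
  ∏-↭ f ↭.refl = refl
  ∏-↭ f (↭.prep x p) = cong (f x *_) (∏-↭ f p)
  ∏-↭ f (↭.swap {xs} {ys} x y p) = begin
    f x * (f y * ∏ xs f) ≡⟨ sym (*-assoc (f x) _ _) ⟩
    (f x * f y) * ∏ xs f ≡⟨ cong₂ _*_ (*-comm (f x) (f y)) (∏-↭ f p) ⟩
    (f y * f x) * ∏ ys f ≡⟨ *-assoc (f y) _ _ ⟩
    f y * (f x * ∏ ys f) ∎
  ∏-↭ f (↭.trans p q) = trans (∏-↭ f p) (∏-↭ f q)

  ∑-filter : ∀ {p} {P : A → Set p} (P? : Decidable P) (L : List A) (f : A → ℚ)
    → ∑ L (λ x → χ (does (P? x)) * f x) ≡ ∑ (filter P? L) f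
  ∑-filter P? [] f = refl
  ∑-filter P? (x ∷ L) f with P? x
  ... | yes _ = cong₂ _+_ (*-identityˡ (f x)) (∑-filter P? L f)
  ... | no _ = trans (cong (_+ _) (*-zeroˡ (f x))) (trans (+-identityˡ _) (∑-filter P? L f))

  ∑-single : (L : List A) → Unique L → (x₀ : A) → x₀ ∈ L → (f : A → ℚ)
    → (∀ {x} → x ∈ L → x ≢ x₀ → f x ≡ 0ℚ) → ∑ L f ≡ f x₀
  ∑-single (x ∷ L) (x∉L ∷ u) x₀ (here refl) f z = trans (cong (f x +_) rest) (+-identityʳ _)
    where
    rest : ∑ L f ≡ 0ℚ
    rest = trans (∑-cong-∈ L (λ m → z (there m) (λ e → All.lookup x∉L m (sym e)))) (∑-zero L)
  ∑-single (x ∷ L) (x∉L ∷ u) x₀ (there m₀) f z =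
    trans (cong (_+ ∑ L f) (z (here refl) (λ e → All.lookup x∉L m₀ e)))
          (trans (+-identityˡ _) (∑-single L u x₀ m₀ f (z ∘ there)))

∑-map : ∀ {a b} {A : Set a} {B : Set b} (g : A → B) (L : List A) (f : B → ℚ) → ∑ (map g L) f ≡ ∑ L (λ x → f (g x))
∑-map g [] f = refl
∑-map g (x ∷ L) f = cong (f (g x) +_) (∑-map g L f)

∏-map : ∀ {a b} {A : Set a} {B : Set b} (g : A → B) (L : List A) (f : B → ℚ) → ∏ (map g L) f ≡ ∏ L (λ x → f (g x))
∏-map g [] f = refl
∏-map g (x ∷ L) f = cong (f (g x) *_) (∏-map g L f)

module _ {a b} {A : Set a} {B : Set b} where

  ∑-swap : (L : List A) (M : List B) (f : A → B → ℚ)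
    → ∑ L (λ x → ∑ M (f x)) ≡ ∑ M (λ y → ∑ L (λ x → f x y))
  ∑-swap [] M f = sym (∑-zero M)
  ∑-swap (x ∷ L) M f =
    trans (cong (∑ M (f x) +_) (∑-swap L M f)) (sym (∑-distrib-+ M (f x) (λ y → ∑ L (λ x → f x y))))

  ∑-product : (L : List A) (M : List B) (f : A → ℚ) (g : B → ℚ)
    → ∑ L (λ x → ∑ M (λ y → f x * g y)) ≡ ∑ L f * ∑ M g
  ∑-product L M f g = trans (∑-cong L (λ x → sym (*-distribˡ-∑ (f x) M g))) (sym (*-distribʳ-∑ (∑ M g) L f))

  ∑-cartesianProductWith : ∀ {c} {C : Set c} (f : A → B → C) (xs : List A) (ys : List B) (g : C → ℚ)
    → ∑ (cartesianProductWith f xs ys) g ≡ ∑ xs (λ x → ∑ ys (λ y → g (f x y)))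
  ∑-cartesianProductWith f [] ys g = refl
  ∑-cartesianProductWith f (x ∷ xs) ys g =
    trans (∑-++ (map (f x) ys) _ g) (cong₂ _+_ (∑-map (f x) ys g) (∑-cartesianProductWith f xs ys g))

  unique-map⁺ : (g : A → B) (L : List A) → Unique L
    → (∀ {x y} → x ∈ L → y ∈ L → g x ≡ g y → x ≡ y) → Unique (map g L)
  unique-map⁺ g [] u inj = []
  unique-map⁺ g (x ∷ L) (x∉L ∷ u) inj =
    All.tabulate fresh ∷ unique-map⁺ g L u (λ m m′ → inj (there m) (there m′))
    where
    fresh : ∀ {z} → z ∈ map g L → g x ≢ z
    fresh m e with ∈-map⁻ g m
    ... | y , y∈L , refl = All.lookup x∉L y∈L (inj (here refl) (there y∈L) e)

  ∑-bij : (L₁ : List A) (L₂ : List B) → Unique L₁ → Unique L₂ → (φ : A → B) (f : B → ℚ)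
    → (∀ {x} → x ∈ L₁ → φ x ∈ L₂)
    → (∀ {x y} → x ∈ L₁ → y ∈ L₁ → φ x ≡ φ y → x ≡ y)
    → (∀ {y} → y ∈ L₂ → ∃ λ x → x ∈ L₁ × φ x ≡ y)
    → ∑ L₁ (λ x → f (φ x)) ≡ ∑ L₂ f
  ∑-bij L₁ L₂ u₁ u₂ φ f into inj onto =
    trans (sym (∑-map φ L₁ f)) (∑-↭ f (unique-↭ (unique-map⁺ φ L₁ u₁ inj) u₂ to from))
    where
    to : ∀ {y} → y ∈ map φ L₁ → y ∈ L₂
    to m with ∈-map⁻ φ m
    ... | x , x∈ , refl = into x∈
    from : ∀ {y} → y ∈ L₂ → y ∈ map φ L₁
    from m with onto m
    ... | x , x∈ , refl = ∈-map⁺ φ x∈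

  ∑-bij-restricted : ∀ {p q} {P : A → Set p} {Q : B → Set q} (L₁ : List A) (L₂ : List B)
    → Unique L₁ → Unique L₂ → (φ : A → B) (P? : Decidable P) (Q? : Decidable Q) (f : B → ℚ)
    → (∀ {x} → x ∈ L₁ → P x → φ x ∈ L₂ × Q (φ x))
    → (∀ {x y} → x ∈ L₁ → y ∈ L₁ → P x → P y → φ x ≡ φ y → x ≡ y)
    → (∀ {y} → y ∈ L₂ → Q y → ∃ λ x → x ∈ L₁ × P x × φ x ≡ y)
    → ∑ L₁ (λ x → χ (does (P? x)) * f (φ x)) ≡ ∑ L₂ (λ y → χ (does (Q? y)) * f y)
  ∑-bij-restricted L₁ L₂ u₁ u₂ φ P? Q? f into inj onto = begin
    ∑ L₁ (λ x → χ (does (P? x)) * f (φ x)) ≡⟨ ∑-filter P? L₁ (λ x → f (φ x)) ⟩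
    ∑ (filter P? L₁) (λ x → f (φ x))  ≡⟨ ∑-bij (filter P? L₁) (filter Q? L₂)
                                           (Uniqueₚ.filter⁺ P? u₁) (Uniqueₚ.filter⁺ Q? u₂) φ f into′ inj′ onto′ ⟩
    ∑ (filter Q? L₂) f                ≡⟨ sym (∑-filter Q? L₂ f) ⟩
    ∑ L₂ (λ y → χ (does (Q? y)) * f y)     ∎
    where
    into′ : ∀ {x} → x ∈ filter P? L₁ → φ x ∈ filter Q? L₂
    into′ m = let (x∈ , px) = ∈-filter⁻ P? m ; (y∈ , qy) = into x∈ px in ∈-filter⁺ Q? y∈ qy
    inj′ : ∀ {x y} → x ∈ filter P? L₁ → y ∈ filter P? L₁ → φ x ≡ φ y → x ≡ y
    inj′ m m′ = let (x∈ , px) = ∈-filter⁻ P? m ; (y∈ , py) = ∈-filter⁻ P? m′ in inj x∈ y∈ px py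
    onto′ : ∀ {y} → y ∈ filter Q? L₂ → ∃ λ x → x ∈ filter P? L₁ × φ x ≡ y
    onto′ m with ∈-filter⁻ Q? m
    ... | y∈ , qy with onto y∈ qy
    ... | x , x∈ , px , refl = x , ∈-filter⁺ P? x∈ px , refl

does-true⇒ : ∀ {p} {P : Set p} (d : Dec P) → does d ≡ true → P
does-true⇒ (yes p) _ = p

χ-zero : ∀ {p} {P : Set p} (d : Dec P) (x : ℚ) → ¬ P → χ (does d) * x ≡ 0ℚ
χ-zero (yes p) x ¬p = ⊥-elim (¬p p)
χ-zero (no _) x _ = *-zeroˡ x

χ-cong : ∀ {p} {P : Set p} (d : Dec P) {x y : ℚ} → (P → x ≡ y) → χ (does d) * x ≡ χ (does d) * y
χ-cong (yes p) h = cong (1ℚ *_) (h p)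
χ-cong (no _) {x} {y} h = trans (*-zeroˡ x) (sym (*-zeroˡ y))

module _ {a} {A : Set a} where

  vecsOf : List A → (r : ℕ) → List (Vec A r)
  vecsOf L zero = [] ∷ []
  vecsOf L (suc r) = cartesianProductWith _∷_ L (vecsOf L r)

  ∑-vecsOf-suc : (L : List A) (r : ℕ) (g : Vec A (suc r) → ℚ)
    → ∑ (vecsOf L (suc r)) g ≡ ∑ L (λ x → ∑ (vecsOf L r) (λ v → g (x ∷ v)))
  ∑-vecsOf-suc L r g = ∑-cartesianProductWith _∷_ L (vecsOf L r) g

  vecsOf-unique : (L : List A) → Unique L → (r : ℕ) → Unique (vecsOf L r)
  vecsOf-unique L u zero = [] ∷ []
  vecsOf-unique L u (suc r) = Uniqueₚ.cartesianProductWith⁺ _∷_ ∷-injective u (vecsOf-unique L u r)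
    where
    ∷-injective : ∀ {w x : A} {y z : Vec A r} → (w ∷ y) ≡ (x ∷ z) → w ≡ x × y ≡ z
    ∷-injective refl = refl , refl

  vecsOf-complete : (L : List A) → (∀ x → x ∈ L) → (r : ℕ) → (v : Vec A r) → v ∈ vecsOf L r
  vecsOf-complete L c zero [] = here refl
  vecsOf-complete L c (suc r) (x ∷ v) = ∈-cartesianProductWith⁺ _∷_ (c x) (vecsOf-complete L c r v)

∏-tabulate : ∀ {a} {A : Set a} (n : ℕ) (h : Fin n → A) (f : A → ℚ)
  → ∏ (List.tabulate h) f ≡ ∏ (allFin n) (λ i → f (h i))
∏-tabulate zero h f = refl
∏-tabulate (suc n) h f =
  cong (f (h zero) *_) (trans (∏-tabulate n (h ∘ suc) f) (sym (∏-tabulate n suc (f ∘ h))))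

∏-allFin-suc : (n : ℕ) (f : Fin (suc n) → ℚ) → ∏ (allFin (suc n)) f ≡ f zero * ∏ (allFin n) (f ∘ suc)
∏-allFin-suc n f = cong (f zero *_) (∏-tabulate n suc f)

bools : List Bool
bools = false ∷ true ∷ []

allVecs : (n : ℕ) → List (Vec Bool n)
allVecs = vecsOf bools

allVecs-unique : (n : ℕ) → Unique (allVecs n)
allVecs-unique = vecsOf-unique bools (((λ ()) ∷ []) ∷ [] ∷ [])

allVecs-complete : (n : ℕ) (v : Vec Bool n) → v ∈ allVecs n
allVecs-complete = vecsOf-complete bools λ where
  false → here refl
  true → there (here refl)

∑-allVecs-suc : (n : ℕ) (g : Vec Bool (suc n) → ℚ)
  → ∑ (allVecs (suc n)) g ≡ ∑ (allVecs n) (λ v → g (false ∷ v)) + ∑ (allVecs n) (λ v → g (true ∷ v))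
∑-allVecs-suc n g = trans (∑-vecsOf-suc bools n g) (cong (∑ (allVecs n) (λ v → g (false ∷ v)) +_) (+-identityʳ _))

Matrix : ℕ → ℕ → Set
Matrix r c = Vec (Vec Bool c) r

allMatrices : (r c : ℕ) → List (Matrix r c)
allMatrices r c = vecsOf (allVecs c) r

allMatrices-unique : (r c : ℕ) → Unique (allMatrices r c)
allMatrices-unique r c = vecsOf-unique (allVecs c) (allVecs-unique c) r

allMatrices-complete : (r c : ℕ) (M : Matrix r c) → M ∈ allMatrices r c
allMatrices-complete r c = vecsOf-complete (allVecs c) (allVecs-complete c) r

allDigraphs : (n : ℕ) → List (Digraph n)
allDigraphs n = allMatrices n n

∑-∏-vecsOf : ∀ {a} {A : Set a} (L : List A) (r : ℕ) (h : Fin r → A → ℚ)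
  → ∑ (vecsOf L r) (λ v → ∏ (allFin r) (λ i → h i (lookup v i))) ≡ ∏ (allFin r) (λ i → ∑ L (h i))
∑-∏-vecsOf L zero h = +-identityʳ 1ℚ
∑-∏-vecsOf L (suc r) h = begin
  ∑ (vecsOf L (suc r)) (λ v → ∏ (allFin (suc r)) (λ i → h i (lookup v i)))
    ≡⟨ ∑-vecsOf-suc L r _ ⟩
  ∑ L (λ x → ∑ (vecsOf L r) (λ v → ∏ (allFin (suc r)) (λ i → h i (lookup (x ∷ v) i))))
    ≡⟨ ∑-cong L (λ x → ∑-cong (vecsOf L r) (λ v → ∏-allFin-suc r (λ i → h i (lookup (x ∷ v) i)))) ⟩
  ∑ L (λ x → ∑ (vecsOf L r) (λ v → h zero x * ∏ (allFin r) (λ i → h (suc i) (lookup v i))))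
    ≡⟨ ∑-product L (vecsOf L r) (h zero) _ ⟩
  ∑ L (h zero) * ∑ (vecsOf L r) (λ v → ∏ (allFin r) (λ i → h (suc i) (lookup v i)))
    ≡⟨ cong (∑ L (h zero) *_) (∑-∏-vecsOf L r (h ∘ suc)) ⟩
  ∑ L (h zero) * ∏ (allFin r) (λ i → ∑ L (h (suc i)))
    ≡⟨ sym (∏-allFin-suc r (λ i → ∑ L (h i))) ⟩
  ∏ (allFin (suc r)) (λ i → ∑ L (h i)) ∎

∑-∏-matrices : (r c : ℕ) (g : Fin r → Fin c → Bool → ℚ)
  → ∑ (allMatrices r c) (λ M → ∏ (allFin r) (λ i → ∏ (allFin c) (λ j → g i j (lookup (lookup M i) j))))
    ≡ ∏ (allFin r) (λ i → ∏ (allFin c) (λ j → g i j false + g i j true))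
∑-∏-matrices r c g = trans (∑-∏-vecsOf (allVecs c) r (λ i row → ∏ (allFin c) (λ j → g i j (lookup row j))))
  (∏-cong (allFin r) (λ i → trans (∑-∏-vecsOf bools c (g i)) (∏-cong (allFin c) (λ j → cong (g i j false +_) (+-identityʳ _)))))

Mask : ℕ → Set
Mask n = Vec Bool n

infix 4 _∋_
_∋_ : ∀ {n} → Mask n → Fin n → Set
S ∋ i = lookup S i ≡ true

_∋?_ : ∀ {n} (S : Mask n) (i : Fin n) → Dec (S ∋ i)
S ∋? i = lookup S i Bool.≟ true

∌⇒false : ∀ {n} {S : Mask n} {i} → ¬ (S ∋ i) → lookup S i ≡ false
∌⇒false = Boolₚ.¬-not

false⇒∌ : ∀ {n} {S : Mask n} {i} → lookup S i ≡ false → ¬ (S ∋ i)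
false⇒∌ e h with () ← trans (sym e) h

vec-ext : ∀ {a} {A : Set a} {n} (u v : Vec A n) → (∀ i → lookup u i ≡ lookup v i) → u ≡ v
vec-ext u v h = trans (sym (Vecₚ.tabulate∘lookup u)) (trans (Vecₚ.tabulate-cong h) (Vecₚ.tabulate∘lookup v))

mask-ext : ∀ {n} (u v : Mask n) → (∀ i → u ∋ i → v ∋ i) → (∀ i → v ∋ i → u ∋ i) → u ≡ v
mask-ext u v f g = vec-ext u v λ i → Boolₚ.⇔→≡ (mk⇔ (f i) (g i))

module _ {n : ℕ} where

  infixl 6 _∪_ _∖_
  _∪_ _∖_ : Mask n → Mask n → Mask n
  S ∪ T = zipWith _∨_ S T
  S ∖ T = zipWith (λ a b → a ∧ not b) S T

  full : Mask n
  full = replicate n true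

  infix 4 _⊆_
  _⊆_ : Mask n → Mask n → Set
  T ⊆ S = ∀ i → T ∋ i → S ∋ i

  _⊆?_ : (T S : Mask n) → Dec (T ⊆ S)
  T ⊆? S = Finₚ.all? (λ i → (T ∋? i) →-dec (S ∋? i))

  Disjoint : Mask n → Mask n → Set
  Disjoint S T = ∀ i → S ∋ i → T ∋ i → ⊥

  Disjoint? : (S T : Mask n) → Dec (Disjoint S T)
  Disjoint? S T = Finₚ.all? (λ i → (S ∋? i) →-dec ((T ∋? i) →-dec no (λ ())))

  full∋ : ∀ i → full ∋ i
  full∋ i = Vecₚ.lookup-replicate i true

  ∪-introˡ : ∀ {S T} → S ⊆ S ∪ T
  ∪-introˡ {S} {T} i h rewrite Vecₚ.lookup-zipWith _∨_ i S T | h = refl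

  ∪-introʳ : ∀ {S T} → T ⊆ S ∪ T
  ∪-introʳ {S} {T} i h rewrite Vecₚ.lookup-zipWith _∨_ i S T | h with lookup S i
  ... | true = refl
  ... | false = refl

  ∪-elim : ∀ {S T i} → S ∪ T ∋ i → S ∋ i ⊎ T ∋ i
  ∪-elim {S} {T} {i} h rewrite Vecₚ.lookup-zipWith _∨_ i S T with lookup S i
  ... | true = inj₁ refl
  ... | false = inj₂ h

  ∖-intro : ∀ {S T i} → S ∋ i → ¬ (T ∋ i) → S ∖ T ∋ i
  ∖-intro {S} {T} {i} h t rewrite Vecₚ.lookup-zipWith (λ a b → a ∧ not b) i S T | h | ∌⇒false {S = T} {i} t = refl

  ∖-elim : ∀ {S T i} → S ∖ T ∋ i → S ∋ i × ¬ (T ∋ i)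
  ∖-elim {S} {T} {i} h rewrite Vecₚ.lookup-zipWith (λ a b → a ∧ not b) i S T with lookup S i | lookup T i
  ... | true | false = refl , λ ()
  ... | true | true with () ← h
  ... | false | _ with () ← h

  ∖-⊆ : ∀ {S T} → S ∖ T ⊆ S
  ∖-⊆ {S} {T} i h = proj₁ (∖-elim {S} {T} {i} h)

  remove : Fin n → Mask n → Mask n
  remove a S = S ∖ Vec.tabulate (λ i → does (i Finₚ.≟ a))

  remove-intro : ∀ {a S i} → S ∋ i → i ≢ a → remove a S ∋ i
  remove-intro {a} {S} {i} h i≢a = ∖-intro {S} {_} {i} h λ t →
    i≢a (does-true⇒ (i Finₚ.≟ a) (trans (sym (Vecₚ.lookup∘tabulate _ i)) t))

  remove-elim : ∀ {a S i} → remove a S ∋ i → S ∋ i × i ≢ a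
  remove-elim {a} {S} {i} h = let (s , t) = ∖-elim {S} {_} {i} h in
    s , λ e → t (trans (Vecₚ.lookup∘tabulate _ i) (dec-true (i Finₚ.≟ a) e))

count : ∀ {n} → Mask n → ℕ
count [] = 0
count (true ∷ v) = suc (count v)
count (false ∷ v) = count v

count≤n : ∀ {n} (S : Mask n) → count S ≤ n
count≤n [] = z≤n
count≤n (true ∷ S) = s≤s (count≤n S)
count≤n (false ∷ S) = ℕₚ.m≤n⇒m≤1+n (count≤n S)

count-mono : ∀ {n} (T S : Mask n) → T ⊆ S → count T ≤ count S
count-mono [] [] h = z≤n
count-mono (true ∷ T) (true ∷ S) h = s≤s (count-mono T S (h ∘ suc))
count-mono (true ∷ T) (false ∷ S) h with () ← h zero refl
count-mono (false ∷ T) (true ∷ S) h = ℕₚ.m≤n⇒m≤1+n (count-mono T S (h ∘ suc))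
count-mono (false ∷ T) (false ∷ S) h = count-mono T S (h ∘ suc)

count-strictMono : ∀ {n} (T S : Mask n) → T ⊆ S → (a : Fin n) → S ∋ a → ¬ (T ∋ a) → count T < count S
count-strictMono (true ∷ T) (true ∷ S) h zero sa ta = ⊥-elim (ta refl)
count-strictMono (false ∷ T) (true ∷ S) h zero sa ta = s≤s (count-mono T S (h ∘ suc))
count-strictMono (true ∷ T) (true ∷ S) h (suc a) sa ta = s≤s (count-strictMono T S (h ∘ suc) a sa ta)
count-strictMono (true ∷ T) (false ∷ S) h (suc a) sa ta with () ← h zero refl
count-strictMono (false ∷ T) (true ∷ S) h (suc a) sa ta = s≤s (ℕₚ.<⇒≤ (count-strictMono T S (h ∘ suc) a sa ta))
count-strictMono (false ∷ T) (false ∷ S) h (suc a) sa ta = count-strictMono T S (h ∘ suc) a sa ta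

count-∖ : ∀ {n} (S T : Mask n) {m : Fin n} → S ∋ m → T ∋ m → count (S ∖ T) < count S
count-∖ S T {m} sm tm = count-strictMono (S ∖ T) S (∖-⊆ {S = S} {T = T}) m sm (λ h → proj₂ (∖-elim {S = S} {T = T} {i = m} h) tm)

count-pos : ∀ {n} (S : Mask n) (a : Fin n) → S ∋ a → 0 < count S
count-pos (true ∷ S) zero h = s≤s z≤n
count-pos (true ∷ S) (suc a) h = s≤s z≤n
count-pos (false ∷ S) (suc a) h = count-pos S a h

least : ∀ {n} → Mask n → Maybe (Fin n)
least [] = nothing
least (true ∷ v) = just zero
least (false ∷ v) = Maybe.map suc (least v)

least-nothing : ∀ {n} (S : Mask n) → least S ≡ nothing → ∀ i → ¬ (S ∋ i)
least-nothing (false ∷ S) e zero ()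
least-nothing (false ∷ S) e (suc i) with least S in e′
least-nothing (false ∷ S) refl (suc i) | nothing = least-nothing S e′ i

least-just : ∀ {n} (S : Mask n) {m} → least S ≡ just m → S ∋ m × (∀ i → toℕ i < toℕ m → ¬ (S ∋ i))
least-just (true ∷ S) refl = refl , λ i ()
least-just (false ∷ S) e with least S in e′
least-just (false ∷ S) refl | just m = proj₁ (least-just S e′) , below
  where
  below : ∀ i → toℕ i < suc (toℕ m) → ¬ ((false ∷ S) ∋ i)
  below zero _ ()
  below (suc i) (s≤s l) = proj₂ (least-just S e′) i l

least-empty : ∀ {n} (S : Mask n) → (∀ i → ¬ (S ∋ i)) → least S ≡ nothing
least-empty [] h = refl
least-empty (true ∷ S) h = ⊥-elim (h zero refl)
least-empty (false ∷ S) h rewrite least-empty S (h ∘ suc) = refl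

least-unique : ∀ {n} (S : Mask n) (m : Fin n) → S ∋ m → (∀ i → toℕ i < toℕ m → ¬ (S ∋ i)) → least S ≡ just m
least-unique (true ∷ S) zero h l = refl
least-unique (true ∷ S) (suc m) h l = ⊥-elim (l zero (s≤s z≤n) refl)
least-unique (false ∷ S) (suc m) h l rewrite least-unique S m h (λ i lt → l (suc i) (s≤s lt)) = refl

least-inhabited : ∀ {n} (S : Mask n) {c} → S ∋ c → ∃ λ m → least S ≡ just m
least-inhabited S {c} sc with least S in e
... | just m = m , refl
... | nothing = ⊥-elim (least-nothing S e c sc)

module _ {n : ℕ} where

  ∪-resolve : ∀ {S K : Mask n} {i} → S ∪ K ∋ i → ¬ K ∋ i → S ∋ i
  ∪-resolve {S = S} {K = K} h ¬c with ∪-elim {S = S} {T = K} h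
  ... | inj₁ s = s
  ... | inj₂ c = ⊥-elim (¬c c)

  ∪-∖-cancel : ∀ (S K : Mask n) → Disjoint S K → (S ∪ K) ∖ K ≡ S
  ∪-∖-cancel S K dj = mask-ext _ _
    (λ i h → let (s∪c , ¬c) = ∖-elim {S = S ∪ K} {T = K} {i = i} h in ∪-resolve {S = S} {K = K} s∪c ¬c)
    (λ i h → ∖-intro {S = S ∪ K} {T = K} {i = i} (∪-introˡ {S = S} {T = K} i h) (dj i h))

  ∖-∪-cancel : ∀ (A K : Mask n) → K ⊆ A → (A ∖ K) ∪ K ≡ A
  ∖-∪-cancel A K sub = mask-ext _ _
    (λ i h → Sum.[ ∖-⊆ {S = A} {T = K} i , sub i ]′ (∪-elim {S = A ∖ K} {T = K} h))
    (λ i a → case (K ∋? i) of λ where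
      (yes c) → ∪-introʳ {S = A ∖ K} {T = K} i c
      (no ¬c) → ∪-introˡ {S = A ∖ K} {T = K} i (∖-intro {S = A} {T = K} {i = i} a ¬c))

  ∪-∖-swap : ∀ (S K T : Mask n) → Disjoint T K → (S ∪ K) ∖ T ≡ (S ∖ T) ∪ K
  ∪-∖-swap S K T dj = mask-ext _ _
    (λ i h → let (s∪c , ¬t) = ∖-elim {S = S ∪ K} {T = T} {i = i} h in
      Sum.[ (λ s → ∪-introˡ {S = S ∖ T} {T = K} i (∖-intro {S = S} {T = T} {i = i} s ¬t)) , ∪-introʳ {S = S ∖ T} {T = K} i ]′
        (∪-elim {S = S} {T = K} s∪c))
    (λ i h → Sum.[ (λ st → let (s , ¬t) = ∖-elim {S = S} {T = T} {i = i} st in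
                            ∖-intro {S = S ∪ K} {T = T} {i = i} (∪-introˡ {S = S} {T = K} i s) ¬t)
                 , (λ c → ∖-intro {S = S ∪ K} {T = T} {i = i} (∪-introʳ {S = S} {T = K} i c) (λ t → dj i t c)) ]′
        (∪-elim {S = S ∖ T} {T = K} h))

-- Paths within a vertex set and the signed indicator η
module _ {n : ℕ} (D : Digraph n) where

  data PathWithin (S : Mask n) (a : Fin n) : Fin n → Set where
    here : PathWithin S a a
    step : ∀ {b c} → PathWithin S a b → edge D b c ≡ true → S ∋ c → PathWithin S a c

  prepend : ∀ {S a b c} → edge D a c ≡ true → S ∋ c → PathWithin S c b → PathWithin S a b
  prepend e sc here = step here e sc
  prepend e sc (step p e′ sd) = step (prepend e sc p) e′ sd

  PathWithin-mono : ∀ {S S′ a b} → S ⊆ S′ → PathWithin S a b → PathWithin S′ a b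
  PathWithin-mono h here = here
  PathWithin-mono h (step p e sc) = step (PathWithin-mono h p) e (h _ sc)

  last-vertex : ∀ {S a b} → PathWithin S a b → a ≡ b ⊎ S ∋ b
  last-vertex here = inj₁ refl
  last-vertex (step p e sc) = inj₂ sc

  first-step : ∀ {S a b} → PathWithin S a b → a ≢ b
    → ∃ λ c → remove a S ∋ c × edge D a c ≡ true × PathWithin (remove a S) c b
  first-step here a≢b = ⊥-elim (a≢b refl)
  first-step {S} {a} (step {b′} {c′} p e sc) a≢b with a Finₚ.≟ b′
  ... | yes refl = c′ , remove-intro {a = a} {S = S} sc (a≢b ∘ sym) , e , here
  ... | no a≢b′ = let (c , rc , ec , p′) = first-step p a≢b′ in
    c , rc , ec , step p′ e (remove-intro {a = a} {S = S} sc (a≢b ∘ sym))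

  -- Fuel bounds the size of S, which shrinks each time the start vertex is removed.
  pathWithin?-fuel : (f : ℕ) (S : Mask n) (a b : Fin n) → count S ≤ f → S ∋ a → Dec (PathWithin S a b)
  pathWithin?-fuel zero S a b le sa = ⊥-elim (ℕₚ.<⇒≱ (count-pos S a sa) le)
  pathWithin?-fuel (suc f) S a b le sa with a Finₚ.≟ b
  ... | yes refl = yes here
  ... | no a≢b with Finₚ.any? via
    where
    smaller : count (remove a S) ≤ f
    smaller = ℕₚ.≤-pred (ℕₚ.≤-trans
      (count-strictMono (remove a S) S (λ i h → proj₁ (remove-elim {a = a} {S = S} h)) a sa
        (λ h → proj₂ (remove-elim {a = a} {S = S} h) refl)) le)
    via : (c : Fin n) → Dec (remove a S ∋ c × edge D a c ≡ true × PathWithin (remove a S) c b)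
    via c with remove a S ∋? c | edge D a c Bool.≟ true
    ... | yes sc | yes ec = map′ (λ p → sc , ec , p) (proj₂ ∘ proj₂) (pathWithin?-fuel f (remove a S) c b smaller sc)
    ... | no ¬sc | _ = no (¬sc ∘ proj₁)
    ... | yes _ | no ¬ec = no (¬ec ∘ proj₁ ∘ proj₂)
  ... | yes (c , sc , ec , p) = yes (prepend ec (proj₁ (remove-elim {a = a} {S = S} sc))
    (PathWithin-mono (λ i h → proj₁ (remove-elim {a = a} {S = S} h)) p))
  ... | no ¬via = no (λ p → ¬via (first-step p a≢b))

  pathWithin? : (S : Mask n) (a b : Fin n) → S ∋ a → Dec (PathWithin S a b)
  pathWithin? S a b = pathWithin?-fuel n S a b (count≤n S)

  StrongOn : Mask n → Set
  StrongOn S = ∀ a b → S ∋ a → S ∋ b → PathWithin S a b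

  StrongOn? : (S : Mask n) → Dec (StrongOn S)
  StrongOn? S = Finₚ.all? λ a → Finₚ.all? λ b → pair a b
    where
    pair : (a b : Fin n) → Dec (S ∋ a → S ∋ b → PathWithin S a b)
    pair a b with S ∋? a | S ∋? b
    ... | yes sa | yes sb = map′ (λ p _ _ → p) (λ f → f sa sb) (pathWithin? S a b sa)
    ... | no ¬sa | _ = yes (λ sa → ⊥-elim (¬sa sa))
    ... | yes _ | no ¬sb = yes (λ _ sb → ⊥-elim (¬sb sb))

  InClosed : Mask n → Set
  InClosed S = ∀ i j → edge D i j ≡ true → S ∋ j → S ∋ i

  InClosed? : (S : Mask n) → Dec (InClosed S)
  InClosed? S = Finₚ.all? λ i → Finₚ.all? λ j →
    (edge D i j Bool.≟ true) →-dec ((S ∋? j) →-dec (S ∋? i))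

  Detached : Mask n → Mask n → Set
  Detached T S = ∀ i j → edge D i j ≡ true → S ∋ i → S ∋ j → lookup T i ≡ lookup T j

  Detached? : (T S : Mask n) → Dec (Detached T S)
  Detached? T S = Finₚ.all? λ i → Finₚ.all? λ j →
    (edge D i j Bool.≟ true) →-dec ((S ∋? i) →-dec ((S ∋? j) →-dec (lookup T i Bool.≟ lookup T j)))

  Block : Mask n → Fin n → Mask n → Set
  Block S m T = T ⊆ S × T ∋ m × Detached T S × StrongOn T

  Block? : (S : Mask n) (m : Fin n) (T : Mask n) → Dec (Block S m T)
  Block? S m T = (T ⊆? S) ×-dec ((T ∋? m) ×-dec (Detached? T S ×-dec StrongOn? T))

  mutual
    η-fuel : ℕ → Mask n → ℚ
    η-fuel zero S = 0ℚ
    η-fuel (suc f) S = η-step f S (least S)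

    η-step : ℕ → Mask n → Maybe (Fin n) → ℚ
    η-step f S nothing = - 1ℚ
    η-step f S (just m) = - ∑ (allVecs n) (λ T → χ (does (Block? S m T)) * η-fuel f (S ∖ T))

  η-fuel-irrelevant : ∀ f f′ S → count S < f → count S < f′ → η-fuel f S ≡ η-fuel f′ S
  η-fuel-irrelevant (suc g) (suc g′) S (s≤s l) (s≤s l′) with least S in e
  ... | nothing = refl
  ... | just m = cong -_ (∑-cong (allVecs n) λ T → χ-cong (Block? S m T) λ b →
          η-fuel-irrelevant g g′ (S ∖ T) (ℕₚ.<-≤-trans (shrinks b) l) (ℕₚ.<-≤-trans (shrinks b) l′))
    where
    shrinks : ∀ {T} → Block S m T → count (S ∖ T) < count S
    shrinks {T} b = count-∖ S T (proj₁ (least-just S e)) (proj₁ (proj₂ b))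

  η : Mask n → ℚ
  η = η-fuel (suc n)

  η-rec : ∀ S {m} → least S ≡ just m → η S ≡ - ∑ (allVecs n) (λ T → χ (does (Block? S m T)) * η (S ∖ T))
  η-rec S {m} e rewrite e = cong -_ (∑-cong (allVecs n) λ T → χ-cong (Block? S m T) λ b →
    η-fuel-irrelevant n (suc n) (S ∖ T)
      (ℕₚ.<-≤-trans (count-∖ S T (proj₁ (least-just S e)) (proj₁ (proj₂ b))) (count≤n S))
      (s≤s (count≤n (S ∖ T))))

module _ {n : ℕ} (D : Digraph n) where

  Detached-path : ∀ (T S P : Mask n) {a b} → Detached D T S → PathWithin D P a b → P ⊆ S → S ∋ a → T ∋ a → T ∋ b
  Detached-path T S P det here ps sa ta = ta
  Detached-path T S P det (step {b′} {c} p e pc) ps sa ta with last-vertex D p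
  ... | inj₁ refl = trans (sym (det b′ c e sa (ps c pc))) ta
  ... | inj₂ pb = trans (sym (det b′ c e (ps b′ pb) (ps c pc))) (Detached-path T S P det p ps sa ta)

  InClosedIn : Mask n → Mask n → Set
  InClosedIn K S = ∀ i j → edge D i j ≡ true → S ∋ i → K ∋ j → K ∋ i

  InClosedIn-path : ∀ (K S P : Mask n) {a b} → InClosedIn K S → PathWithin D P a b → P ⊆ S → S ∋ a → K ∋ b → K ∋ a
  InClosedIn-path K S P cl here ps sa cb = cb
  InClosedIn-path K S P cl (step {b′} {c} p e pc) ps sa cc with last-vertex D p
  ... | inj₁ refl = cl b′ c e sa cc
  ... | inj₂ pb = InClosedIn-path K S P cl p ps sa (cl b′ c e (ps b′ pb) cc)

  InClosed⇒InClosedIn : ∀ K S → InClosed D K → InClosedIn K S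
  InClosed⇒InClosedIn K S cl i j e _ cj = cl i j e cj

  Block-unique : ∀ S {m T T′} → Block D S m T → Block D S m T′ → T ≡ T′
  Block-unique S {m} {T} {T′} (ts , tm , det , sc) (ts′ , tm′ , det′ , sc′) = mask-ext T T′
    (λ x tx → Detached-path T′ S T det′ (sc m x tm tx) ts (ts m tm) tm′)
    (λ x tx → Detached-path T S T′ det (sc′ m x tm′ tx) ts′ (ts′ m tm′) tm)

  η-block : ∀ S {m} K → least S ≡ just m → Block D S m K → η D S ≡ - η D (S ∖ K)
  η-block S {m} K e bC = begin
    η D S                                                           ≡⟨ η-rec D S e ⟩
    - ∑ (allVecs n) (λ T → χ (does (Block? D S m T)) * η D (S ∖ T)) ≡⟨ cong -_ single ⟩
    - (χ (does (Block? D S m K)) * η D (S ∖ K))                     ≡⟨ cong (λ b → - (χ b * η D (S ∖ K))) (dec-true (Block? D S m K) bC) ⟩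
    - (1ℚ * η D (S ∖ K))                                            ≡⟨ cong -_ (*-identityˡ _) ⟩
    - η D (S ∖ K)                                                   ∎
    where
    single = ∑-single (allVecs n) (allVecs-unique n) K (allVecs-complete n K) _
      λ {T} _ T≢C → χ-zero (Block? D S m T) _ (λ bT → T≢C (Block-unique S bT bC))

  NoEdgesBetween : Mask n → Mask n → Set
  NoEdgesBetween S K = ∀ i j → edge D i j ≡ true → (S ∋ i → K ∋ j → ⊥) × (K ∋ i → S ∋ j → ⊥)

  module _ (S K : Mask n) (dj : Disjoint S K) (ne : NoEdgesBetween S K) where

    stays-in : ∀ (P : Mask n) {a b} → PathWithin D P a b → P ⊆ S ∪ K → S ∋ a → S ∋ b
    stays-in P here ps sa = sa
    stays-in P (step {b′} {c} p e pc) ps sa with ∪-elim {S = S} {T = K} (ps c pc)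
    ... | inj₁ s = s
    ... | inj₂ cc = ⊥-elim (proj₁ (ne b′ c e) (stays-in P p ps sa) cc)

    Block-∪⇒Block : ∀ {m T} → S ∋ m → Block D (S ∪ K) m T → Block D S m T
    Block-∪⇒Block {m} {T} sm (sub , tm , det , sc) =
      (λ x tx → stays-in T (sc m x tm tx) sub sm) , tm ,
      (λ i j e si sj → det i j e (∪-introˡ {S = S} {T = K} i si) (∪-introˡ {S = S} {T = K} j sj)) , sc

    Block⇒Block-∪ : ∀ {m T} → Block D S m T → Block D (S ∪ K) m T
    Block⇒Block-∪ {m} {T} (sub , tm , det , sc) = (λ i ti → ∪-introˡ {S = S} {T = K} i (sub i ti)) , tm , det′ , sc
      where
      det′ : Detached D T (S ∪ K)
      det′ i j e si sj with ∪-elim {S = S} {T = K} si | ∪-elim {S = S} {T = K} sj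
      ... | inj₁ a | inj₁ b = det i j e a b
      ... | inj₁ a | inj₂ b = ⊥-elim (proj₁ (ne i j e) a b)
      ... | inj₂ a | inj₁ b = ⊥-elim (proj₂ (ne i j e) a b)
      ... | inj₂ a | inj₂ b = Boolₚ.⇔→≡ (mk⇔ (λ ti → ⊥-elim (dj i (sub i ti) a)) (λ tj → ⊥-elim (dj j (sub j tj) b)))

    Block-of-K : ∀ {m} → K ∋ m → StrongOn D K → Block D (S ∪ K) m K
    Block-of-K {m} cm sc = ∪-introʳ {S = S} {T = K} , cm , det , sc
      where
      det : Detached D K (S ∪ K)
      det i j e si sj with ∪-elim {S = S} {T = K} si | ∪-elim {S = S} {T = K} sj
      ... | inj₁ a | inj₁ b = Boolₚ.⇔→≡ (mk⇔ (λ ci → ⊥-elim (dj i a ci)) (λ cj → ⊥-elim (dj j b cj)))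
      ... | inj₁ a | inj₂ b = ⊥-elim (proj₁ (ne i j e) a b)
      ... | inj₂ a | inj₁ b = ⊥-elim (proj₂ (ne i j e) a b)
      ... | inj₂ a | inj₂ b = trans a (sym b)

  η-∪-strong : ∀ f (S K : Mask n) → count S < f → ∀ {c₀} → K ∋ c₀ → StrongOn D K
    → Disjoint S K → NoEdgesBetween S K → η D (S ∪ K) ≡ - η D S
  η-∪-strong (suc f) S K (s≤s lt) {c₀} cc₀ scK dj ne
    with least-inhabited (S ∪ K) (∪-introʳ {S = S} {T = K} c₀ cc₀)
  ... | m , e with K ∋? m
  ... | yes cm = trans (η-block (S ∪ K) K e (Block-of-K S K dj ne cm scK)) (cong (λ X → - η D X) (∪-∖-cancel S K dj))
  ... | no ¬cm = begin
    η D (S ∪ K)                                                                          ≡⟨ η-rec D (S ∪ K) e ⟩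
    - ∑ (allVecs n) (λ T → χ (does (Block? D (S ∪ K) m T)) * η D ((S ∪ K) ∖ T))          ≡⟨ cong -_ (∑-cong (allVecs n) term) ⟩
    - ∑ (allVecs n) (λ T → - (χ (does (Block? D S m T)) * η D (S ∖ T)))                  ≡⟨ cong -_ (∑-neg (allVecs n) _) ⟩
    - (- ∑ (allVecs n) (λ T → χ (does (Block? D S m T)) * η D (S ∖ T)))                  ≡⟨ cong -_ (sym (η-rec D S eS)) ⟩
    - η D S                                                                              ∎
    where
    sm : S ∋ m
    sm = ∪-resolve {S = S} {K = K} (proj₁ (least-just (S ∪ K) e)) ¬cm
    eS : least S ≡ just m
    eS = least-unique S m sm (λ i lt si → proj₂ (least-just (S ∪ K) e) i lt (∪-introˡ {S = S} {T = K} i si))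
    shrunk : ∀ {T} → Block D S m T → η D ((S ∪ K) ∖ T) ≡ - η D (S ∖ T)
    shrunk {T} (sub , tm , _) = trans (cong (η D) (∪-∖-swap S K T (λ i t c → dj i (sub i t) c)))
      (η-∪-strong f (S ∖ T) K (ℕₚ.<-≤-trans (count-∖ S T sm tm) lt) cc₀ scK
        (λ i st ci → dj i (∖-⊆ {S = S} {T = T} i st) ci)
        (λ i j e → (λ si cj → proj₁ (ne i j e) (∖-⊆ {S = S} {T = T} i si) cj) ,
                   (λ ci sj → proj₂ (ne i j e) ci (∖-⊆ {S = S} {T = T} j sj))))
    term : ∀ T → χ (does (Block? D (S ∪ K) m T)) * η D ((S ∪ K) ∖ T) ≡ - (χ (does (Block? D S m T)) * η D (S ∖ T))
    term T = begin
      χ (does (Block? D (S ∪ K) m T)) * η D ((S ∪ K) ∖ T)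
        ≡⟨ cong (λ b → χ b * η D ((S ∪ K) ∖ T))
             (does-⇔ (mk⇔ (Block-∪⇒Block S K dj ne sm) (Block⇒Block-∪ S K dj ne)) (Block? D (S ∪ K) m T) (Block? D S m T)) ⟩
      χ (does (Block? D S m T)) * η D ((S ∪ K) ∖ T) ≡⟨ χ-cong (Block? D S m T) shrunk ⟩
      χ (does (Block? D S m T)) * - η D (S ∖ T)     ≡⟨ sym (neg-distribʳ-* (χ (does (Block? D S m T))) (η D (S ∖ T))) ⟩
      - (χ (does (Block? D S m T)) * η D (S ∖ T))   ∎

  η-vanishes : ∀ f (S K : Mask n) → count S < f → K ⊆ S → ∀ {k₀} → K ∋ k₀ → StrongOn D K → InClosedIn K S
    → ∀ p q → edge D p q ≡ true → K ∋ p → S ∋ q → ¬ K ∋ q → η D S ≡ 0ℚ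
  η-vanishes (suc f) S K (s≤s lt) sub {k₀} kk₀ scK cl p q epq kp sq ¬kq
    with least-inhabited S (sub k₀ kk₀)
  ... | m , e = trans (η-rec D S e) (cong -_ (trans (∑-cong (allVecs n) term) (∑-zero (allVecs n))))
    where
    sm : S ∋ m
    sm = proj₁ (least-just S e)
    term : ∀ T → χ (does (Block? D S m T)) * η D (S ∖ T) ≡ 0ℚ
    term T = trans (χ-cong (Block? D S m T) rest) (*-zeroʳ (χ (does (Block? D S m T))))
      where
      -- K lies entirely inside or entirely outside the detached block T, and q is not in T.
      rest : Block D S m T → η D (S ∖ T) ≡ 0ℚ
      rest (subT , tm , det , scT) = η-vanishes f (S ∖ T) K (ℕₚ.<-≤-trans (count-∖ S T sm tm) lt)
          (λ x kx → ∖-intro {S = S} {T = T} {i = x} (sub x kx) (λ tx → apart x tx kx)) kk₀ scK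
          (λ i j e si kj → cl i j e (∖-⊆ {S = S} {T = T} i si) kj) p q epq kp
          (∖-intro {S = S} {T = T} {i = q} sq (λ tq → apart p (trans (det p q epq (sub p kp) sq) tq) kp)) ¬kq
        where
        apart : ∀ x → T ∋ x → K ∋ x → ⊥
        apart x tx kx = ¬kq (InClosedIn-path K S T cl (scT q x tq tx) subT (subT q tq) kx)
          where
          tq : T ∋ q
          tq = trans (sym (det p q epq (sub p kp) sq)) (Detached-path T S K det (scK x p kx kp) sub (sub x kx) tx)

  SourcePiece : Set
  SourcePiece = Σ (Mask n) λ K → (∃ λ k → K ∋ k) × InClosed D K × StrongOn D K

  -- Repeatedly pass to a smaller nonempty in-closed subset; a minimal one is strongly connected,
  -- since the vertices reaching a fixed vertex b form such a subset.
  source-piece-fuel : ∀ f (S : Mask n) → count S ≤ f → InClosed D S → (s : Fin n) → S ∋ s → SourcePiece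
  source-piece-fuel zero S le cl s ss = ⊥-elim (ℕₚ.<⇒≱ (count-pos S s ss) le)
  source-piece-fuel (suc f) S le cl s ss with Any.any? Smaller? (allVecs n)
    where
    Smaller : Mask n → Set
    Smaller T = T ⊆ S × InClosed D T × (∃ λ t → T ∋ t) × (∃ λ x → S ∋ x × ¬ T ∋ x)
    Smaller? : (T : Mask n) → Dec (Smaller T)
    Smaller? T = (T ⊆? S) ×-dec (InClosed? D T ×-dec (Finₚ.any? (T ∋?_) ×-dec Finₚ.any? (λ x → (S ∋? x) ×-dec ¬? (T ∋? x))))
  ... | yes any = let (T , sub , clT , (t , t∈T) , (x , sx , ¬tx)) = Any.satisfied any in
    source-piece-fuel f T (ℕₚ.≤-pred (ℕₚ.≤-trans (count-strictMono T S sub x sx ¬tx) le)) clT t t∈T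
  ... | no none = S , (s , ss) , cl , strong
    where
    strong : StrongOn D S
    strong a b sa sb with pathWithin? D S a b sa
    ... | yes pab = pab
    ... | no ¬pab = ⊥-elim (none (lose (allVecs-complete n R) (R⊆S , R-closed , (b , R-intro b sb here) , (a , sa , ¬pab ∘ proj₂ ∘ R-elim a))))
      where
      reaches : (x : Fin n) → Dec (S ∋ x) → Bool
      reaches x (yes sx) = does (pathWithin? D S x b sx)
      reaches x (no _) = false
      R : Mask n
      R = Vec.tabulate (λ x → reaches x (S ∋? x))
      R-elim : ∀ x → R ∋ x → S ∋ x × PathWithin D S x b
      R-elim x h with S ∋? x | trans (sym (Vecₚ.lookup∘tabulate (λ x → reaches x (S ∋? x)) x)) h
      ... | yes sx | r = sx , does-true⇒ (pathWithin? D S x b sx) r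
      R-intro : ∀ x → S ∋ x → PathWithin D S x b → R ∋ x
      R-intro x sx p = trans (Vecₚ.lookup∘tabulate (λ x → reaches x (S ∋? x)) x) (reach (S ∋? x))
        where
        reach : (d : Dec (S ∋ x)) → reaches x d ≡ true
        reach (yes sx′) = dec-true (pathWithin? D S x b sx′) p
        reach (no ¬sx) = ⊥-elim (¬sx sx)
      R⊆S : R ⊆ S
      R⊆S x h = proj₁ (R-elim x h)
      R-closed : InClosed D R
      R-closed i j e rj = let (sj , pj) = R-elim j rj in R-intro i (cl i j e sj) (prepend D e sj pj)

  source-piece : Fin n → SourcePiece
  source-piece v = source-piece-fuel n full (count≤n full) (λ i _ _ _ → full∋ i) v (full∋ v)

  ¬InClosed⇒entering-edge : ∀ A → ¬ InClosed D A → ∃ λ i → ∃ λ j → edge D i j ≡ true × A ∋ j × ¬ A ∋ i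
  ¬InClosed⇒entering-edge A ¬cl with Finₚ.¬∀⟶∃¬ n _ (λ i → Finₚ.all? λ j → (edge D i j Bool.≟ true) →-dec ((A ∋? j) →-dec (A ∋? i))) ¬cl
  ... | i , ¬∀j with Finₚ.¬∀⟶∃¬ n _ (λ j → (edge D i j Bool.≟ true) →-dec ((A ∋? j) →-dec (A ∋? i))) ¬∀j
  ... | j , ¬ij with edge D i j Bool.≟ true | A ∋? j | A ∋? i
  ... | yes e | yes aj | no ¬ai = i , j , e , aj , ¬ai
  ... | yes e | yes aj | yes ai = ⊥-elim (¬ij (λ _ _ → ai))
  ... | yes e | no ¬aj | _ = ⊥-elim (¬ij (λ _ aj → ⊥-elim (¬aj aj)))
  ... | no ¬e | _ | _ = ⊥-elim (¬ij (λ e → ⊥-elim (¬e e)))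

  ¬Disjoint⇒common : ∀ A K → ¬ Disjoint A K → ∃ λ i → A ∋ i × K ∋ i
  ¬Disjoint⇒common A K ¬dj with Finₚ.¬∀⟶∃¬ n _ (λ i → (A ∋? i) →-dec ((K ∋? i) →-dec no (λ ()))) ¬dj
  ... | i , ¬i with A ∋? i | K ∋? i
  ... | yes a | yes k = i , a , k
  ... | no ¬a | _ = ⊥-elim (¬i (λ a → ⊥-elim (¬a a)))
  ... | yes _ | no ¬k = ⊥-elim (¬i (λ _ k → ⊥-elim (¬k k)))

  -- Sign-reversing involution: toggle a fixed source piece K₀. An in-closed set meeting K₀ contains it;
  -- A ↦ A ∪ K₀ pairs the in-closed sets disjoint from K₀ with those containing K₀, with opposite η,
  -- except when A ∪ K₀ is in-closed but A is not, where an edge leaves K₀ and η (A ∪ K₀) = 0.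
  ∑-η-InClosed≡0 : Fin n → ∑ (allVecs n) (λ A → χ (does (InClosed? D A)) * η D A) ≡ 0ℚ
  ∑-η-InClosed≡0 v = begin
    ∑ (allVecs n) (λ A → χ (does (InClosed? D A)) * η D A)
      ≡⟨ ∑-cong (allVecs n) split ⟩
    ∑ (allVecs n) (λ A → Disj A + Cont A)
      ≡⟨ ∑-distrib-+ (allVecs n) Disj Cont ⟩
    ∑ (allVecs n) Disj + ∑ (allVecs n) Cont
      ≡⟨ cong (∑ (allVecs n) Disj +_) (sym toggle) ⟩
    ∑ (allVecs n) Disj + ∑ (allVecs n) (λ A → χ (does (Toggle? A)) * η D (A ∪ K₀))
      ≡⟨ sym (∑-distrib-+ (allVecs n) Disj _) ⟩
    ∑ (allVecs n) (λ A → Disj A + χ (does (Toggle? A)) * η D (A ∪ K₀))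
      ≡⟨ ∑-cong (allVecs n) cancel ⟩
    ∑ (allVecs n) (λ _ → 0ℚ)
      ≡⟨ ∑-zero (allVecs n) ⟩
    0ℚ ∎
    where
    K₀ : Mask n
    K₀ = proj₁ (source-piece v)
    k₀ : Fin n
    k₀ = proj₁ (proj₁ (proj₂ (source-piece v)))
    kk₀ : K₀ ∋ k₀
    kk₀ = proj₂ (proj₁ (proj₂ (source-piece v)))
    clK₀ : InClosed D K₀
    clK₀ = proj₁ (proj₂ (proj₂ (source-piece v)))
    scK₀ : StrongOn D K₀
    scK₀ = proj₂ (proj₂ (proj₂ (source-piece v)))

    Disj Cont : Mask n → ℚ
    Disj A = χ (does (InClosed? D A ×-dec Disjoint? A K₀)) * η D A
    Cont A = χ (does (InClosed? D A ×-dec (K₀ ⊆? A))) * η D A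

    Toggle? : (A : Mask n) → Dec (Disjoint A K₀ × InClosed D (A ∪ K₀))
    Toggle? A = Disjoint? A K₀ ×-dec InClosed? D (A ∪ K₀)

    meets⇒contains : ∀ A x → InClosed D A → A ∋ x → K₀ ∋ x → K₀ ⊆ A
    meets⇒contains A x cl ax kx y ky =
      InClosedIn-path A full K₀ (InClosed⇒InClosedIn A full cl) (scK₀ y x ky kx) (λ i _ → full∋ i) (full∋ y) ax

    split : ∀ A → χ (does (InClosed? D A)) * η D A
                ≡ χ (does (InClosed? D A ×-dec Disjoint? A K₀)) * η D A + χ (does (InClosed? D A ×-dec (K₀ ⊆? A))) * η D A
    split A = by-cases (InClosed? D A) (Disjoint? A K₀) (K₀ ⊆? A)
      where
      open +-*-Solver
      by-cases : (cl? : Dec (InClosed D A)) (dj? : Dec (Disjoint A K₀)) (sub? : Dec (K₀ ⊆ A))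
        → χ (does cl?) * η D A ≡ χ (does (cl? ×-dec dj?)) * η D A + χ (does (cl? ×-dec sub?)) * η D A
      by-cases (yes _) (yes dj) (yes sub) = ⊥-elim (dj k₀ (sub k₀ kk₀) kk₀)
      by-cases (yes _) (yes _) (no _) = solve 1 (λ x → con 1ℚ :* x := con 1ℚ :* x :+ con 0ℚ :* x) refl (η D A)
      by-cases (yes _) (no _) (yes _) = solve 1 (λ x → con 1ℚ :* x := con 0ℚ :* x :+ con 1ℚ :* x) refl (η D A)
      by-cases (yes cl) (no ¬dj) (no ¬sub) =
        let (x , ax , kx) = ¬Disjoint⇒common A K₀ ¬dj in ⊥-elim (¬sub (meets⇒contains A x cl ax kx))
      by-cases (no _) _ _ = solve 1 (λ x → con 0ℚ :* x := con 0ℚ :* x :+ con 0ℚ :* x) refl (η D A)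

    toggle : ∑ (allVecs n) (λ A → χ (does (Toggle? A)) * η D (A ∪ K₀)) ≡ ∑ (allVecs n) Cont
    toggle = ∑-bij-restricted (allVecs n) (allVecs n) (allVecs-unique n) (allVecs-unique n) (_∪ K₀)
      Toggle? (λ A → InClosed? D A ×-dec (K₀ ⊆? A)) (η D)
      (λ {A} _ (_ , cl) → allVecs-complete n _ , cl , ∪-introʳ {S = A} {T = K₀})
      (λ {A} {B} _ _ (djA , _) (djB , _) e → mask-ext A B
        (λ i ai → ∪-resolve {S = B} {K = K₀} (subst (_∋ i) e (∪-introˡ {S = A} {T = K₀} i ai)) (djA i ai))
        (λ i bi → ∪-resolve {S = A} {K = K₀} (subst (_∋ i) (sym e) (∪-introˡ {S = B} {T = K₀} i bi)) (djB i bi)))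
      (λ {A} _ (cl , sub) → A ∖ K₀ , allVecs-complete n _ ,
        ((λ i h k → proj₂ (∖-elim {S = A} {T = K₀} {i = i} h) k) , subst (InClosed D) (sym (∖-∪-cancel A K₀ sub)) cl) ,
        ∖-∪-cancel A K₀ sub)

    InClosed-∪ : ∀ A → InClosed D A → InClosed D (A ∪ K₀)
    InClosed-∪ A cl i j e h with ∪-elim {S = A} {T = K₀} h
    ... | inj₁ a = ∪-introˡ {S = A} {T = K₀} i (cl i j e a)
    ... | inj₂ k = ∪-introʳ {S = A} {T = K₀} i (clK₀ i j e k)

    cancel : ∀ A → χ (does (InClosed? D A ×-dec Disjoint? A K₀)) * η D A
                   + χ (does (Disjoint? A K₀ ×-dec InClosed? D (A ∪ K₀))) * η D (A ∪ K₀) ≡ 0ℚ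
    cancel A = by-cases (Disjoint? A K₀) (InClosed? D A) (InClosed? D (A ∪ K₀))
      where
      open +-*-Solver
      by-cases : (dj? : Dec (Disjoint A K₀)) (cl? : Dec (InClosed D A)) (cl∪? : Dec (InClosed D (A ∪ K₀)))
        → χ (does (cl? ×-dec dj?)) * η D A + χ (does (dj? ×-dec cl∪?)) * η D (A ∪ K₀) ≡ 0ℚ
      by-cases (no _) (yes _) _ = cong₂ _+_ (*-zeroˡ (η D A)) (*-zeroˡ (η D (A ∪ K₀)))
      by-cases (no _) (no _) _ = cong₂ _+_ (*-zeroˡ (η D A)) (*-zeroˡ (η D (A ∪ K₀)))
      by-cases (yes _) (no _) (no _) = cong₂ _+_ (*-zeroˡ (η D A)) (*-zeroˡ (η D (A ∪ K₀)))
      by-cases (yes dj) (yes cl) (no ¬cl∪) = ⊥-elim (¬cl∪ (InClosed-∪ A cl))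
      by-cases (yes dj) (yes cl) (yes _) = begin
        1ℚ * η D A + 1ℚ * η D (A ∪ K₀) ≡⟨ cong (λ z → 1ℚ * η D A + 1ℚ * z) flip ⟩
        1ℚ * η D A + 1ℚ * - η D A      ≡⟨ solve 1 (λ x → con 1ℚ :* x :+ con 1ℚ :* (:- x) := con 0ℚ) refl (η D A) ⟩
        0ℚ                             ∎
        where
        flip : η D (A ∪ K₀) ≡ - η D A
        flip = η-∪-strong (suc n) A K₀ (s≤s (count≤n A)) kk₀ scK₀ dj
          (λ i j e → (λ ai kj → dj i ai (clK₀ i j e kj)) , (λ ki aj → dj i (cl i j e aj) ki))
      by-cases (yes dj) (no ¬cl) (yes cl∪) = begin
        0ℚ * η D A + 1ℚ * η D (A ∪ K₀) ≡⟨ cong (λ z → 0ℚ * η D A + 1ℚ * z) vanish ⟩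
        0ℚ * η D A + 1ℚ * 0ℚ           ≡⟨ solve 1 (λ x → con 0ℚ :* x :+ con 1ℚ :* con 0ℚ := con 0ℚ) refl (η D A) ⟩
        0ℚ                             ∎
        where
        vanish : η D (A ∪ K₀) ≡ 0ℚ
        vanish with ¬InClosed⇒entering-edge A ¬cl
        ... | p , q , e , aq , ¬ap =
          η-vanishes (suc n) (A ∪ K₀) K₀ (s≤s (count≤n (A ∪ K₀))) (∪-introʳ {S = A} {T = K₀}) kk₀ scK₀
            (InClosed⇒InClosedIn K₀ (A ∪ K₀) clK₀) p q e kp (∪-introˡ {S = A} {T = K₀} q aq) (dj q aq)
          where
          kp : K₀ ∋ p
          kp with ∪-elim {S = A} {T = K₀} (cl∪ p q e (∪-introˡ {S = A} {T = K₀} q aq))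
          ... | inj₁ ap = ⊥-elim (¬ap ap)
          ... | inj₂ k = k

-- D′ is the subgraph of D induced on the image of the order-embedding e.
module Embedding {n k : ℕ} (D : Digraph n) (D′ : Digraph k)
  (e : Fin k → Fin n) (r : Fin n → Maybe (Fin k))
  (r∘e : ∀ a → r (e a) ≡ just a) (e∘r : ∀ i a → r i ≡ just a → e a ≡ i)
  (e-mono : ∀ a b → toℕ a < toℕ b → toℕ (e a) < toℕ (e b))
  (edge-e : ∀ a b → edge D′ a b ≡ edge D (e a) (e b)) where

  e-injective : ∀ {a b} → e a ≡ e b → a ≡ b
  e-injective {a} {b} eq = Maybeₚ.just-injective (trans (sym (r∘e a)) (trans (cong r eq) (r∘e b)))

  image : Mask k → Mask n
  image S′ = Vec.tabulate λ i → maybe (lookup S′) false (r i)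

  lookup-image : ∀ S′ a → lookup (image S′) (e a) ≡ lookup S′ a
  lookup-image S′ a = trans (Vecₚ.lookup∘tabulate _ (e a)) (cong (maybe (lookup S′) false) (r∘e a))

  image-elim : ∀ S′ i → image S′ ∋ i → ∃ λ a → e a ≡ i × S′ ∋ a
  image-elim S′ i h with r i in ri | trans (sym (Vecₚ.lookup∘tabulate (λ i → maybe (lookup S′) false (r i)) i)) h
  ... | just a | s = a , e∘r i a ri , s

  ∈-image : ∀ {S′ a} → S′ ∋ a → image S′ ∋ e a
  ∈-image {S′} {a} h = trans (lookup-image S′ a) h

  ∈-image⁻ : ∀ {S′ a} → image S′ ∋ e a → S′ ∋ a
  ∈-image⁻ {S′} {a} h = trans (sym (lookup-image S′ a)) h

  preimage : Mask n → Mask k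
  preimage T = Vec.tabulate λ a → lookup T (e a)

  image-preimage : ∀ T → (∀ i → T ∋ i → ∃ λ a → e a ≡ i) → image (preimage T) ≡ T
  image-preimage T onto = mask-ext _ _
    (λ i h → let (a , ea , pa) = image-elim (preimage T) i h in
      subst (T ∋_) ea (trans (sym (Vecₚ.lookup∘tabulate (λ a → lookup T (e a)) a)) pa))
    (λ i h → let (a , ea) = onto i h in
      subst (image (preimage T) ∋_) ea
        (trans (lookup-image (preimage T) a) (trans (Vecₚ.lookup∘tabulate (λ a → lookup T (e a)) a) (subst (T ∋_) (sym ea) h))))

  image-injective : ∀ {T₁ T₂} → image T₁ ≡ image T₂ → T₁ ≡ T₂
  image-injective {T₁} {T₂} eq =
    vec-ext T₁ T₂ λ a → trans (sym (lookup-image T₁ a)) (trans (cong (λ T → lookup T (e a)) eq) (lookup-image T₂ a))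

  image-∖ : ∀ S′ T′ → image (S′ ∖ T′) ≡ image S′ ∖ image T′
  image-∖ S′ T′ = mask-ext _ _
    (λ i h → let (a , ea , pa) = image-elim (S′ ∖ T′) i h
                 (s , ¬t) = ∖-elim {S = S′} {T = T′} {i = a} pa in
      subst (image S′ ∖ image T′ ∋_) ea
        (∖-intro {S = image S′} {T = image T′} {i = e a} (∈-image {S′} s) (¬t ∘ ∈-image⁻ {T′})))
    (λ i h → let (s , ¬t) = ∖-elim {S = image S′} {T = image T′} {i = i} h
                 (a , ea , sa) = image-elim S′ i s in
      subst (image (S′ ∖ T′) ∋_) ea
        (∈-image {S′ ∖ T′} (∖-intro {S = S′} {T = T′} {i = a} sa (λ t → ¬t (subst (image T′ ∋_) ea (∈-image {T′} t))))))

  path-image : ∀ {S′ a b} → PathWithin D′ S′ a b → PathWithin D (image S′) (e a) (e b)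
  path-image here = here
  path-image {S′} (step {b′} {c} p ed sc) = step (path-image p) (trans (sym (edge-e b′ c)) ed) (∈-image {S′} sc)

  path-preimage : ∀ {S′ a y} → PathWithin D (image S′) (e a) y → ∀ b → e b ≡ y → PathWithin D′ S′ a b
  path-preimage here b eb with e-injective eb
  ... | refl = here
  path-preimage {S′} {a} (step {b₀} {c} p ed sc) b eb with last-vertex D p
  ... | inj₁ refl = step (path-preimage p a refl) (trans (edge-e a b) (trans (cong (edge D (e a)) eb) ed))
    (∈-image⁻ {S′} (subst (image S′ ∋_) (sym eb) sc))
  ... | inj₂ pb₀ = let (b₀′ , eb₀ , _) = image-elim S′ b₀ pb₀ in
    step (path-preimage p b₀′ eb₀) (trans (edge-e b₀′ b) (trans (cong₂ (edge D) eb₀ eb) ed))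
      (∈-image⁻ {S′} (subst (image S′ ∋_) (sym eb) sc))

  StrongOn-image : ∀ S′ → StrongOn D′ S′ ⇔ StrongOn D (image S′)
  StrongOn-image S′ = mk⇔ to from
    where
    to : StrongOn D′ S′ → StrongOn D (image S′)
    to sc x y hx hy with image-elim S′ x hx | image-elim S′ y hy
    ... | a , refl , sa | b , refl , sb = path-image (sc a b sa sb)
    from : StrongOn D (image S′) → StrongOn D′ S′
    from sc a b sa sb = path-preimage (sc (e a) (e b) (∈-image {S′} sa) (∈-image {S′} sb)) b refl

  Detached-image : ∀ T′ S′ → Detached D′ T′ S′ ⇔ Detached D (image T′) (image S′)
  Detached-image T′ S′ = mk⇔ to from
    where
    to : Detached D′ T′ S′ → Detached D (image T′) (image S′)
    to det x y ed hx hy with image-elim S′ x hx | image-elim S′ y hy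
    ... | a , refl , sa | b , refl , sb =
      trans (lookup-image T′ a) (trans (det a b (trans (edge-e a b) ed) sa sb) (sym (lookup-image T′ b)))
    from : Detached D (image T′) (image S′) → Detached D′ T′ S′
    from det a b ed sa sb = trans (sym (lookup-image T′ a))
      (trans (det (e a) (e b) (trans (sym (edge-e a b)) ed) (∈-image {S′} sa) (∈-image {S′} sb)) (lookup-image T′ b))

  ⊆-image : ∀ T′ S′ → T′ ⊆ S′ ⇔ image T′ ⊆ image S′
  ⊆-image T′ S′ = mk⇔ to from
    where
    to : T′ ⊆ S′ → image T′ ⊆ image S′
    to sub i h with image-elim T′ i h
    ... | a , refl , ta = ∈-image {S′} (sub a ta)
    from : image T′ ⊆ image S′ → T′ ⊆ S′
    from sub a h = ∈-image⁻ {S′} (sub (e a) (∈-image {T′} h))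

  Block-image : ∀ S′ m T′ → Block D′ S′ m T′ ⇔ Block D (image S′) (e m) (image T′)
  Block-image S′ m T′ = mk⇔
    (λ (a , b , c , d) → to (⊆-image T′ S′) a , ∈-image {T′} b , to (Detached-image T′ S′) c , to (StrongOn-image T′) d)
    (λ (a , b , c , d) → from (⊆-image T′ S′) a , ∈-image⁻ {T′} b , from (Detached-image T′ S′) c , from (StrongOn-image T′) d)
    where open Equivalence

  least-image : ∀ S′ → least (image S′) ≡ Maybe.map e (least S′)
  least-image S′ with least S′ in eq
  ... | nothing = least-empty (image S′) λ i h → let (a , _ , sa) = image-elim S′ i h in least-nothing S′ eq a sa
  ... | just m = least-unique (image S′) (e m) (∈-image {S′} (proj₁ (least-just S′ eq))) below
    where
    below : ∀ i → toℕ i < toℕ (e m) → ¬ (image S′ ∋ i)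
    below i lt h with image-elim S′ i h
    ... | a , refl , sa with ℕₚ.<-cmp (toℕ a) (toℕ m)
    ... | tri< a<m _ _ = proj₂ (least-just S′ eq) a a<m sa
    ... | tri≈ _ a≡m _ = ℕₚ.<-irrefl (cong (toℕ ∘ e) (Finₚ.toℕ-injective a≡m)) lt
    ... | tri> _ _ m<a = ℕₚ.<-asym lt (e-mono m a m<a)

  η-fuel-image : ∀ f S′ → η-fuel D′ f S′ ≡ η-fuel D f (image S′)
  η-fuel-image zero S′ = refl
  η-fuel-image (suc f) S′ rewrite least-image S′ with least S′
  ... | nothing = refl
  ... | just m = cong -_ (begin
    ∑ (allVecs k) (λ T′ → χ (does (Block? D′ S′ m T′)) * η-fuel D′ f (S′ ∖ T′))
      ≡⟨ ∑-cong (allVecs k) (λ T′ → cong₂ (λ b x → χ b * x)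
           (does-⇔ (Block-image S′ m T′) (Block? D′ S′ m T′) (Block? D (image S′) (e m) (image T′)))
           (trans (η-fuel-image f (S′ ∖ T′)) (cong (η-fuel D f) (image-∖ S′ T′)))) ⟩
    ∑ (allVecs k) (λ T′ → χ (does (Block? D (image S′) (e m) (image T′))) * η-fuel D f (image S′ ∖ image T′))
      ≡⟨ ∑-bij-restricted (allVecs k) (allVecs n) (allVecs-unique k) (allVecs-unique n) image
           (λ T′ → Block? D (image S′) (e m) (image T′)) (Block? D (image S′) (e m)) (λ T → η-fuel D f (image S′ ∖ T))
           (λ {T′} _ b → allVecs-complete n _ , b)
           (λ _ _ _ _ → image-injective)
           (λ {T} _ b → let inv = image-preimage T λ i t → let (a , ea , _) = image-elim S′ i (proj₁ b i t) in a , ea in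
             preimage T , allVecs-complete k _ , subst (Block D (image S′) (e m)) (sym inv) b , inv) ⟩
    ∑ (allVecs n) (λ T → χ (does (Block? D (image S′) (e m) T)) * η-fuel D f (image S′ ∖ T)) ∎)

  η-image : ∀ S′ → η D′ S′ ≡ η D (image S′)
  η-image S′ = begin
    η-fuel D′ (suc k) S′       ≡⟨ η-fuel-irrelevant D′ (suc k) (suc (k ℕ.+ n)) S′ (s≤s (count≤n S′))
                                    (s≤s (ℕₚ.≤-trans (count≤n S′) (ℕₚ.m≤m+n k n))) ⟩
    η-fuel D′ (suc (k ℕ.+ n)) S′ ≡⟨ η-fuel-image (suc (k ℕ.+ n)) S′ ⟩
    η-fuel D (suc (k ℕ.+ n)) (image S′) ≡⟨ η-fuel-irrelevant D (suc (k ℕ.+ n)) (suc n) (image S′)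
                                             (s≤s (ℕₚ.≤-trans (count≤n (image S′)) (ℕₚ.m≤n+m n k))) (s≤s (count≤n (image S′))) ⟩
    η-fuel D (suc n) (image S′) ∎

count∁ : ∀ {n} → Mask n → ℕ
count∁ [] = 0
count∁ (true ∷ v) = count∁ v
count∁ (false ∷ v) = suc (count∁ v)

count+count∁ : ∀ {n} (A : Mask n) → count A ℕ.+ count∁ A ≡ n
count+count∁ [] = refl
count+count∁ (true ∷ A) = cong suc (count+count∁ A)
count+count∁ (false ∷ A) = trans (ℕₚ.+-suc (count A) (count∁ A)) (cong suc (count+count∁ A))

count∁≡ : ∀ {n} (A : Mask n) → count∁ A ≡ n ∸ count A
count∁≡ A = trans (sym (ℕₚ.m+n∸m≡n (count A) (count∁ A))) (cong (_∸ count A) (count+count∁ A))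

-- The vertices of A, then those outside A, each listed in increasing order.
Part : ∀ {n} → Mask n → Set
Part A = Fin (count A) ⊎ Fin (count∁ A)

join : ∀ {n} (A : Mask n) → Part A → Fin n
join (true ∷ A) (inj₁ zero) = zero
join (true ∷ A) (inj₁ (suc a)) = suc (join A (inj₁ a))
join (true ∷ A) (inj₂ b) = suc (join A (inj₂ b))
join (false ∷ A) (inj₁ a) = suc (join A (inj₁ a))
join (false ∷ A) (inj₂ zero) = zero
join (false ∷ A) (inj₂ (suc b)) = suc (join A (inj₂ b))

split : ∀ {n} (A : Mask n) → Fin n → Part A
split (true ∷ A) zero = inj₁ zero
split (true ∷ A) (suc i) = Sum.map suc id (split A i)
split (false ∷ A) zero = inj₂ zero
split (false ∷ A) (suc i) = Sum.map id suc (split A i)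

join∘split : ∀ {n} (A : Mask n) i → join A (split A i) ≡ i
join∘split (true ∷ A) zero = refl
join∘split (true ∷ A) (suc i) with split A i | join∘split A i
... | inj₁ a | e = cong suc e
... | inj₂ b | e = cong suc e
join∘split (false ∷ A) zero = refl
join∘split (false ∷ A) (suc i) with split A i | join∘split A i
... | inj₁ a | e = cong suc e
... | inj₂ b | e = cong suc e

split∘join : ∀ {n} (A : Mask n) x → split A (join A x) ≡ x
split∘join (true ∷ A) (inj₁ zero) = refl
split∘join (true ∷ A) (inj₁ (suc a)) rewrite split∘join A (inj₁ a) = refl
split∘join (true ∷ A) (inj₂ b) rewrite split∘join A (inj₂ b) = refl
split∘join (false ∷ A) (inj₁ a) rewrite split∘join A (inj₁ a) = refl
split∘join (false ∷ A) (inj₂ zero) = refl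
split∘join (false ∷ A) (inj₂ (suc b)) rewrite split∘join A (inj₂ b) = refl

join-injective : ∀ {n} (A : Mask n) {x y} → join A x ≡ join A y → x ≡ y
join-injective A {x} {y} e = trans (sym (split∘join A x)) (trans (cong (split A) e) (split∘join A y))

join-inside : ∀ {n} (A : Mask n) a → A ∋ join A (inj₁ a)
join-inside (true ∷ A) zero = refl
join-inside (true ∷ A) (suc a) = join-inside A a
join-inside (false ∷ A) a = join-inside A a

join-outside : ∀ {n} (A : Mask n) b → lookup A (join A (inj₂ b)) ≡ false
join-outside (true ∷ A) b = join-outside A b
join-outside (false ∷ A) zero = refl
join-outside (false ∷ A) (suc b) = join-outside A b

join-mono₁ : ∀ {n} (A : Mask n) a b → toℕ a < toℕ b → toℕ (join A (inj₁ a)) < toℕ (join A (inj₁ b))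
join-mono₁ (true ∷ A) zero (suc b) lt = s≤s z≤n
join-mono₁ (true ∷ A) (suc a) (suc b) (s≤s lt) = s≤s (join-mono₁ A a b lt)
join-mono₁ (false ∷ A) a b lt = s≤s (join-mono₁ A a b lt)

join-mono₂ : ∀ {n} (A : Mask n) a b → toℕ a < toℕ b → toℕ (join A (inj₂ a)) < toℕ (join A (inj₂ b))
join-mono₂ (true ∷ A) a b lt = s≤s (join-mono₂ A a b lt)
join-mono₂ (false ∷ A) zero (suc b) lt = s≤s z≤n
join-mono₂ (false ∷ A) (suc a) (suc b) (s≤s lt) = s≤s (join-mono₂ A a b lt)

unjoin₁ : ∀ {n} (A : Mask n) → Fin n → Maybe (Fin (count A))
unjoin₁ A i = Sum.[ just , (λ _ → nothing) ]′ (split A i)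

unjoin₂ : ∀ {n} (A : Mask n) → Fin n → Maybe (Fin (count∁ A))
unjoin₂ A i = Sum.[ (λ _ → nothing) , just ]′ (split A i)

unjoin₁∘join : ∀ {n} (A : Mask n) a → unjoin₁ A (join A (inj₁ a)) ≡ just a
unjoin₁∘join A a rewrite split∘join A (inj₁ a) = refl

unjoin₂∘join : ∀ {n} (A : Mask n) b → unjoin₂ A (join A (inj₂ b)) ≡ just b
unjoin₂∘join A b rewrite split∘join A (inj₂ b) = refl

join∘unjoin₁ : ∀ {n} (A : Mask n) i a → unjoin₁ A i ≡ just a → join A (inj₁ a) ≡ i
join∘unjoin₁ A i a eq with split A i | join∘split A i
join∘unjoin₁ A i a refl | inj₁ .a | e = e

join∘unjoin₂ : ∀ {n} (A : Mask n) i b → unjoin₂ A i ≡ just b → join A (inj₂ b) ≡ i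
join∘unjoin₂ A i b eq with split A i | join∘split A i
join∘unjoin₂ A i b refl | inj₂ .b | e = e

∏-split : ∀ {n} (A : Mask n) (f : Fin n → ℚ)
  → ∏ (allFin n) f ≡ ∏ (allFin (count A)) (λ a → f (join A (inj₁ a))) * ∏ (allFin (count∁ A)) (λ b → f (join A (inj₂ b)))
∏-split {n} A f = begin
  ∏ (allFin n) f                                  ≡⟨ sym (∏-↭ f (unique-↭ unique-joins (Uniqueₚ.allFin⁺ n) (λ _ → ∈-allFin _) complete)) ⟩
  ∏ (map (join A) parts) f                        ≡⟨ ∏-map (join A) parts f ⟩
  ∏ parts (f ∘ join A)                            ≡⟨ ∏-++ (map inj₁ (allFin (count A))) _ _ ⟩
  ∏ (map inj₁ (allFin (count A))) (f ∘ join A) * ∏ (map inj₂ (allFin (count∁ A))) (f ∘ join A)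
                                                  ≡⟨ cong₂ _*_ (∏-map inj₁ (allFin (count A)) _) (∏-map inj₂ (allFin (count∁ A)) _) ⟩
  ∏ (allFin (count A)) (λ a → f (join A (inj₁ a))) * ∏ (allFin (count∁ A)) (λ b → f (join A (inj₂ b))) ∎
  where
  parts : List (Part A)
  parts = map inj₁ (allFin (count A)) ++ map inj₂ (allFin (count∁ A))
  unique-joins : Unique (map (join A) parts)
  unique-joins = Uniqueₚ.map⁺ (join-injective A)
    (Uniqueₚ.++⁺ (Uniqueₚ.map⁺ inj₁-injective (Uniqueₚ.allFin⁺ _)) (Uniqueₚ.map⁺ inj₂-injective (Uniqueₚ.allFin⁺ _)) disjoint)
    where
    inj₁-injective : ∀ {x y : Fin (count A)} → _≡_ {A = Part A} (inj₁ x) (inj₁ y) → x ≡ y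
    inj₁-injective refl = refl
    inj₂-injective : ∀ {x y : Fin (count∁ A)} → _≡_ {A = Part A} (inj₂ x) (inj₂ y) → x ≡ y
    inj₂-injective refl = refl
    disjoint : ∀ {v} → v ∈ map inj₁ (allFin (count A)) × v ∈ map inj₂ (allFin (count∁ A)) → ⊥
    disjoint (m₁ , m₂) with ∈-map⁻ inj₁ m₁ | ∈-map⁻ inj₂ m₂
    ... | _ , _ , refl | _ , _ , ()
  complete : ∀ {i} → i ∈ allFin n → i ∈ map (join A) parts
  complete {i} _ = subst (_∈ map (join A) parts) (join∘split A i) (∈-map⁺ (join A) (∈-parts (split A i)))
    where
    ∈-parts : ∀ x → x ∈ parts
    ∈-parts (inj₁ a) = ∈-++⁺ˡ (∈-map⁺ inj₁ (∈-allFin a))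
    ∈-parts (inj₂ b) = ∈-++⁺ʳ (map inj₁ (allFin (count A))) (∈-map⁺ inj₂ (∈-allFin b))

-- A digraph on [n] is the same as its two induced subgraphs on A and on its complement,
-- together with the two matrices of edges from A to the complement and back.
module Decomposition {n : ℕ} (A : Mask n) where

  k m : ℕ
  k = count A
  m = count∁ A

  j₁ : Fin k → Fin n
  j₁ a = join A (inj₁ a)
  j₂ : Fin m → Fin n
  j₂ b = join A (inj₂ b)

  Blocks : Set
  Blocks = Digraph k × Digraph m × Matrix k m × Matrix m k

  entry : Blocks → Part A → Part A → Bool
  entry (D₁ , D₂ , X , Y) (inj₁ a) (inj₁ a′) = edge D₁ a a′
  entry (D₁ , D₂ , X , Y) (inj₁ a) (inj₂ b) = lookup (lookup X a) b
  entry (D₁ , D₂ , X , Y) (inj₂ b) (inj₁ a) = lookup (lookup Y b) a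
  entry (D₁ , D₂ , X , Y) (inj₂ b) (inj₂ b′) = edge D₂ b b′

  assemble : Blocks → Digraph n
  assemble q = Vec.tabulate λ i → Vec.tabulate λ j → entry q (split A i) (split A j)

  submatrix : ∀ {r c} → Digraph n → (Fin r → Fin n) → (Fin c → Fin n) → Matrix r c
  submatrix P f g = Vec.tabulate λ a → Vec.tabulate λ b → edge P (f a) (g b)

  disassemble : Digraph n → Blocks
  disassemble P = submatrix P j₁ j₁ , submatrix P j₂ j₂ , submatrix P j₁ j₂ , submatrix P j₂ j₁

  lookup² : ∀ {r c} (f : Fin r → Fin c → Bool) a b → lookup (lookup (Vec.tabulate λ a → Vec.tabulate (f a)) a) b ≡ f a b
  lookup² f a b = trans (cong (λ row → lookup row b) (Vecₚ.lookup∘tabulate _ a)) (Vecₚ.lookup∘tabulate (f a) b)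

  edge-assemble : ∀ q i j → edge (assemble q) i j ≡ entry q (split A i) (split A j)
  edge-assemble q i j = lookup² (λ i j → entry q (split A i) (split A j)) i j

  edge-assemble-join : ∀ q x z → edge (assemble q) (join A x) (join A z) ≡ entry q x z
  edge-assemble-join q x z = trans (edge-assemble q (join A x) (join A z)) (cong₂ (entry q) (split∘join A x) (split∘join A z))

  entry-disassemble : ∀ P x z → entry (disassemble P) x z ≡ edge P (join A x) (join A z)
  entry-disassemble P (inj₁ a) (inj₁ a′) = lookup² _ a a′
  entry-disassemble P (inj₁ a) (inj₂ b) = lookup² _ a b
  entry-disassemble P (inj₂ b) (inj₁ a) = lookup² _ b a
  entry-disassemble P (inj₂ b) (inj₂ b′) = lookup² _ b b′

  matrix-ext : ∀ {r c} (M N : Matrix r c) → (∀ a b → lookup (lookup M a) b ≡ lookup (lookup N a) b) → M ≡ N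
  matrix-ext M N h = vec-ext M N λ a → vec-ext (lookup M a) (lookup N a) (h a)

  assemble∘disassemble : ∀ P → assemble (disassemble P) ≡ P
  assemble∘disassemble P = matrix-ext _ _ λ i j → trans (edge-assemble (disassemble P) i j)
    (trans (entry-disassemble P (split A i) (split A j)) (cong₂ (edge P) (join∘split A i) (join∘split A j)))

  disassemble∘assemble : ∀ q → disassemble (assemble q) ≡ q
  disassemble∘assemble q = cong₂ _,_ (block inj₁ inj₁ λ _ _ → refl) (cong₂ _,_ (block inj₂ inj₂ λ _ _ → refl)
    (cong₂ _,_ (block inj₁ inj₂ λ _ _ → refl) (block inj₂ inj₁ λ _ _ → refl)))
    where
    block : ∀ {r c} (ι₁ : Fin r → Part A) (ι₂ : Fin c → Part A) {M : Matrix r c}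
      → (∀ a b → entry q (ι₁ a) (ι₂ b) ≡ lookup (lookup M a) b) → submatrix (assemble q) (join A ∘ ι₁) (join A ∘ ι₂) ≡ M
    block ι₁ ι₂ h = matrix-ext _ _ λ a b → trans (lookup² _ a b) (trans (edge-assemble-join q (ι₁ a) (ι₂ b)) (h a b))

  allBlocks : List Blocks
  allBlocks = List.cartesianProduct (allDigraphs k)
    (List.cartesianProduct (allDigraphs m) (List.cartesianProduct (allMatrices k m) (allMatrices m k)))

  allBlocks-unique : Unique allBlocks
  allBlocks-unique = Uniqueₚ.cartesianProduct⁺ (allMatrices-unique k k)
    (Uniqueₚ.cartesianProduct⁺ (allMatrices-unique m m) (Uniqueₚ.cartesianProduct⁺ (allMatrices-unique k m) (allMatrices-unique m k)))

  allBlocks-complete : ∀ q → q ∈ allBlocks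
  allBlocks-complete (D₁ , D₂ , X , Y) = ∈-cartesianProduct⁺ (allMatrices-complete k k D₁)
    (∈-cartesianProduct⁺ (allMatrices-complete m m D₂) (∈-cartesianProduct⁺ (allMatrices-complete k m X) (allMatrices-complete m k Y)))

  ∑-allDigraphs-blocks : (F : Digraph n → ℚ) → ∑ (allDigraphs n) F
    ≡ ∑ (allDigraphs k) λ D₁ → ∑ (allDigraphs m) λ D₂ → ∑ (allMatrices k m) λ X → ∑ (allMatrices m k) λ Y → F (assemble (D₁ , D₂ , X , Y))
  ∑-allDigraphs-blocks F = begin
    ∑ (allDigraphs n) F ≡⟨ sym (∑-bij allBlocks (allDigraphs n) allBlocks-unique (allMatrices-unique n n) assemble F
                             (λ _ → allMatrices-complete n n _)
                             (λ {q} {q′} _ _ e → trans (sym (disassemble∘assemble q)) (trans (cong disassemble e) (disassemble∘assemble q′)))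
                             (λ {P} _ → disassemble P , allBlocks-complete (disassemble P) , assemble∘disassemble P)) ⟩
    ∑ allBlocks (F ∘ assemble)
      ≡⟨ ∑-cartesianProductWith _,_ (allDigraphs k) _ _ ⟩
    _ ≡⟨ ∑-cong (allDigraphs k) (λ D₁ → trans (∑-cartesianProductWith _,_ (allDigraphs m) _ _)
           (∑-cong (allDigraphs m) λ D₂ → ∑-cartesianProductWith _,_ (allMatrices k m) (allMatrices m k) _)) ⟩
    _ ∎

  zeroMatrix : (r c : ℕ) → Matrix r c
  zeroMatrix r c = replicate r (replicate c false)

  lookup-zeroMatrix : ∀ {r c} (a : Fin r) (b : Fin c) → lookup (lookup (zeroMatrix r c) a) b ≡ false
  lookup-zeroMatrix {r} {c} a b = trans (cong (λ row → lookup row b) (Vecₚ.lookup-replicate a (replicate c false))) (Vecₚ.lookup-replicate b false)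

  zeroMatrix-unique : ∀ {r c} (M : Matrix r c) → (∀ a b → lookup (lookup M a) b ≢ true) → M ≡ zeroMatrix r c
  zeroMatrix-unique M none = matrix-ext M _ λ a b → trans (Boolₚ.¬-not (none a b)) (sym (lookup-zeroMatrix a b))

  inside-vertex : ∀ i → A ∋ i → ∃ λ a → j₁ a ≡ i
  inside-vertex i h with split A i | join∘split A i
  ... | inj₁ a | e = a , e
  ... | inj₂ b | e with () ← trans (sym (join-outside A b)) (subst (A ∋_) (sym e) h)

  outside-vertex : ∀ i → ¬ A ∋ i → ∃ λ b → j₂ b ≡ i
  outside-vertex i h with split A i | join∘split A i
  ... | inj₁ a | e = ⊥-elim (h (subst (A ∋_) e (join-inside A a)))
  ... | inj₂ b | e = b , e

  module Assembled (q : Blocks) where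

    P : Digraph n
    P = assemble q

    D₁ = proj₁ q
    D₂ = proj₁ (proj₂ q)
    X = proj₁ (proj₂ (proj₂ q))
    Y = proj₂ (proj₂ (proj₂ q))

    module E₁ = Embedding P D₁ j₁ (unjoin₁ A) (unjoin₁∘join A) (join∘unjoin₁ A) (join-mono₁ A)
      (λ a b → sym (edge-assemble-join q (inj₁ a) (inj₁ b)))
    module E₂ = Embedding P D₂ j₂ (unjoin₂ A) (unjoin₂∘join A) (join∘unjoin₂ A) (join-mono₂ A)
      (λ a b → sym (edge-assemble-join q (inj₂ a) (inj₂ b)))

    image₁-full : E₁.image full ≡ A
    image₁-full = mask-ext _ _
      (λ i h → let (a , ea , _) = E₁.image-elim full i h in subst (A ∋_) ea (join-inside A a))
      (λ i h → let (a , ea) = inside-vertex i h in subst (E₁.image full ∋_) ea (E₁.∈-image {full} (full∋ a)))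

    image₂-full : E₂.image full ≡ full ∖ A
    image₂-full = mask-ext _ _
      (λ i h → let (b , eb , _) = E₂.image-elim full i h in
        subst (full ∖ A ∋_) eb (∖-intro {S = full} {T = A} {i = j₂ b} (full∋ (j₂ b)) (false⇒∌ {S = A} (join-outside A b))))
      (λ i h → let (b , eb) = outside-vertex i (proj₂ (∖-elim {S = full} {T = A} {i = i} h)) in
        subst (E₂.image full ∋_) eb (E₂.∈-image {full} (full∋ b)))

    η-inside : η P A ≡ η D₁ full
    η-inside = sym (trans (E₁.η-image full) (cong (η P) image₁-full))

    η-outside : η P (full ∖ A) ≡ η D₂ full
    η-outside = sym (trans (E₂.η-image full) (cong (η P) image₂-full))

    StrongOn-inside : StrongOn P A ⇔ StrongOn D₁ full
    StrongOn-inside = subst (λ T → StrongOn P T ⇔ StrongOn D₁ full) image₁-full (Function.Properties.Equivalence.sym (E₁.StrongOn-image full))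

    InClosed⇔no-edges-in : InClosed P A ⇔ Y ≡ zeroMatrix m k
    InClosed⇔no-edges-in = mk⇔ to from
      where
      to : InClosed P A → Y ≡ zeroMatrix m k
      to cl = zeroMatrix-unique Y λ b a y → false⇒∌ {S = A} (join-outside A b)
        (cl (j₂ b) (j₁ a) (trans (edge-assemble-join q (inj₂ b) (inj₁ a)) y) (join-inside A a))
      from : Y ≡ zeroMatrix m k → InClosed P A
      from y≡0 i j e aj with split A i in si | split A j in sj
      ... | inj₁ a | _ = subst (A ∋_) (trans (cong (join A) (sym si)) (join∘split A i)) (join-inside A a)
      ... | inj₂ b | inj₂ b′ with () ← trans (sym (join-outside A b′)) (subst (A ∋_) (sym (trans (cong (join A) (sym sj)) (join∘split A j))) aj)
      ... | inj₂ b | inj₁ a′ with () ← trans (sym e) (trans (edge-assemble q i j)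
              (trans (cong₂ (entry q) si sj) (trans (cong (λ M → lookup (lookup M b) a′) y≡0) (lookup-zeroMatrix b a′))))

    Detached⇔no-edges-across : Detached P A full ⇔ (X ≡ zeroMatrix k m × Y ≡ zeroMatrix m k)
    Detached⇔no-edges-across = mk⇔ to from
      where
      to : Detached P A full → X ≡ zeroMatrix k m × Y ≡ zeroMatrix m k
      to det = zeroMatrix-unique X (λ a b x → true≢false (trans (sym (join-inside A a))
                 (trans (det (j₁ a) (j₂ b) (trans (edge-assemble-join q (inj₁ a) (inj₂ b)) x) (full∋ (j₁ a)) (full∋ (j₂ b))) (join-outside A b))))
             , zeroMatrix-unique Y (λ b a y → true≢false (sym (trans (sym (join-outside A b))
                 (trans (det (j₂ b) (j₁ a) (trans (edge-assemble-join q (inj₂ b) (inj₁ a)) y) (full∋ (j₂ b)) (full∋ (j₁ a))) (join-inside A a)))))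
        where
        true≢false : true ≢ false
        true≢false ()
      from : X ≡ zeroMatrix k m × Y ≡ zeroMatrix m k → Detached P A full
      from (x≡0 , y≡0) i j e _ _ = trans (cong (lookup A) (sym (join∘split A i)))
        (trans (same-side (split A i) (split A j) (trans (sym e) (edge-assemble q i j))) (cong (lookup A) (join∘split A j)))
        where
        same-side : ∀ x z → true ≡ entry q x z → lookup A (join A x) ≡ lookup A (join A z)
        same-side (inj₁ a) (inj₁ a′) _ = trans (join-inside A a) (sym (join-inside A a′))
        same-side (inj₂ b) (inj₂ b′) _ = trans (join-outside A b) (sym (join-outside A b′))
        same-side (inj₁ a) (inj₂ b) h with () ← trans h (trans (cong (λ M → lookup (lookup M a) b) x≡0) (lookup-zeroMatrix a b))
        same-side (inj₂ b) (inj₁ a) h with () ← trans h (trans (cong (λ M → lookup (lookup M b) a) y≡0) (lookup-zeroMatrix b a))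

^-+ : ∀ x a b → x ^ (a ℕ.+ b) ≡ x ^ a * x ^ b
^-+ x zero b = sym (*-identityˡ _)
^-+ x (suc a) b = trans (cong (x *_) (^-+ x a b)) (sym (*-assoc x _ _))

^-distrib-* : ∀ x z a → (x * z) ^ a ≡ x ^ a * z ^ a
^-distrib-* x z zero = refl
^-distrib-* x z (suc a) = trans (cong (x * z *_) (^-distrib-* x z a))
  (solve 4 (λ x z p q → (x :* z) :* (p :* q) := (x :* p) :* (z :* q)) refl x z (x ^ a) (z ^ a))
  where open +-*-Solver

1^ : ∀ a → 1ℚ ^ a ≡ 1ℚ
1^ zero = refl
1^ (suc a) = trans (*-identityˡ _) (1^ a)

∏-const : ∀ m c → ∏ (allFin m) (λ _ → c) ≡ c ^ m
∏-const zero c = refl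
∏-const (suc m) c = trans (∏-allFin-suc m (λ _ → c)) (cong (c *_) (∏-const m c))

∏-one : ∀ m → ∏ (allFin m) (λ _ → 1ℚ) ≡ 1ℚ
∏-one m = trans (∏-const m 1ℚ) (1^ m)

ℕtoℚ-suc : ∀ n → ℕtoℚ (suc n) ≡ 1ℚ + ℕtoℚ n
ℕtoℚ-suc n = begin
  ℕtoℚ (suc n)                                             ≡⟨ cong (λ z → (ℤ.+ 1 ℤ.* ℤ.+ 1 ℤ.+ z) ℚ./ 1) (sym (ℤₚ.*-identityʳ (ℤ.+ n))) ⟩
  (ℤ.+ 1 ℤ.* ℤ.+ 1 ℤ.+ ℤ.+ n ℤ.* ℤ.+ 1) ℚ./ 1             ≡⟨⟩
  1ℚ + ℚ.mkℚ (ℤ.+ n) 0 (Coprime.sym (Coprime.1-coprimeTo n)) ≡⟨ cong (1ℚ +_) (sym (normalize-coprime (Coprime.sym (Coprime.1-coprimeTo n)))) ⟩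
  1ℚ + ℕtoℚ n                                              ∎

ℕtoℚ-+ : ∀ m n → ℕtoℚ (m ℕ.+ n) ≡ ℕtoℚ m + ℕtoℚ n
ℕtoℚ-+ zero n = sym (+-identityˡ _)
ℕtoℚ-+ (suc m) n = begin
  ℕtoℚ (suc (m ℕ.+ n))    ≡⟨ ℕtoℚ-suc (m ℕ.+ n) ⟩
  1ℚ + ℕtoℚ (m ℕ.+ n)     ≡⟨ cong (1ℚ +_) (ℕtoℚ-+ m n) ⟩
  1ℚ + (ℕtoℚ m + ℕtoℚ n)  ≡⟨ sym (+-assoc 1ℚ (ℕtoℚ m) (ℕtoℚ n)) ⟩
  1ℚ + ℕtoℚ m + ℕtoℚ n    ≡⟨ cong (_+ ℕtoℚ n) (sym (ℕtoℚ-suc m)) ⟩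
  ℕtoℚ (suc m) + ℕtoℚ n   ∎

qbinom-above : ∀ q N k → N < k → qbinom q N k ≡ 0ℚ
qbinom-above q zero (suc k) lt = refl
qbinom-above q (suc N) (suc k) (s≤s lt) = begin
  qbinom q N k + q ^ suc k * qbinom q N (suc k) ≡⟨ cong₂ (λ a b → a + q ^ suc k * b) (qbinom-above q N k lt) (qbinom-above q N (suc k) (ℕₚ.m<n⇒m<1+n lt)) ⟩
  0ℚ + q ^ suc k * 0ℚ                           ≡⟨ cong (0ℚ +_) (*-zeroʳ (q ^ suc k)) ⟩
  0ℚ                                            ∎

qbinom-diagonal : ∀ q N → qbinom q N N ≡ 1ℚ
qbinom-diagonal q zero = refl
qbinom-diagonal q (suc N) = begin
  qbinom q N N + q ^ suc N * qbinom q N (suc N) ≡⟨ cong₂ (λ a b → a + q ^ suc N * b) (qbinom-diagonal q N) (qbinom-above q N (suc N) (ℕₚ.n<1+n N)) ⟩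
  1ℚ + q ^ suc N * 0ℚ                           ≡⟨ cong (1ℚ +_) (*-zeroʳ (q ^ suc N)) ⟩
  1ℚ                                            ∎

interval : ℕ → ℕ → List ℕ
interval i zero = []
interval i (suc m) = i ∷ interval (suc i) m

range≡interval : ∀ a b → range a b ≡ interval a (suc b ∸ a)
range≡interval a b = go (suc b ∸ a) a b refl
  where
  ∸-pred : ∀ X i m → suc X ∸ i ≡ suc m → X ∸ i ≡ m
  ∸-pred X zero m e = ℕₚ.suc-injective e
  ∸-pred zero (suc zero) m ()
  ∸-pred zero (suc (suc i)) m ()
  ∸-pred (suc X) (suc i) m e = ∸-pred X i m e
  go : ∀ m i X → suc X ∸ i ≡ m → range i X ≡ interval i m
  go m i X e with suc X ∸ i in eq
  go .zero i X refl | zero = refl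
  go .(suc m) i X refl | suc m rewrite sym (∸-pred X i m eq) = cong (i ∷_) (go (X ∸ i) (suc i) X refl)

Σ[⋯]≡∑ : ∀ a b (f : ℕ → ℚ) → Σ[ a ⋯ b ] f ≡ ∑ (interval a (suc b ∸ a)) f
Σ[⋯]≡∑ a b f = trans (sumℚ-map (range a b) f) (cong (λ L → ∑ L f) (range≡interval a b))

∈-interval⁻ : ∀ i m {x} → x ∈ interval i m → i ≤ x × x < i ℕ.+ m
∈-interval⁻ i (suc m) (here refl) = ℕₚ.≤-refl , ℕₚ.m<m+n i (s≤s z≤n)
∈-interval⁻ i (suc m) {x} (there p) = let (a , b) = ∈-interval⁻ (suc i) m p in
  ℕₚ.<⇒≤ a , subst (x <_) (sym (ℕₚ.+-suc i m)) b

∈-interval⁺ : ∀ i m x → i ≤ x → x < i ℕ.+ m → x ∈ interval i m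
∈-interval⁺ i zero x le lt = ⊥-elim (ℕₚ.<-irrefl refl (ℕₚ.≤-<-trans (subst (_≤ x) (sym (ℕₚ.+-identityʳ i)) le) lt))
∈-interval⁺ i (suc m) x le lt with ℕₚ.m≤n⇒m<n∨m≡n le
... | inj₂ refl = here refl
... | inj₁ i<x = there (∈-interval⁺ (suc i) m x i<x (subst (x <_) (ℕₚ.+-suc i m) lt))

interval-unique : ∀ i m → Unique (interval i m)
interval-unique i zero = []
interval-unique i (suc m) = All.tabulate (λ p e → ℕₚ.<-irrefl e (proj₁ (∈-interval⁻ (suc i) m p))) ∷ interval-unique (suc i) m

∑-interval-suc : ∀ i m (f : ℕ → ℚ) → ∑ (interval (suc i) m) f ≡ ∑ (interval i m) (f ∘ suc)
∑-interval-suc i zero f = refl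
∑-interval-suc i (suc m) f = cong (f (suc i) +_) (∑-interval-suc (suc i) m f)

∑-interval-last : ∀ i m (f : ℕ → ℚ) → ∑ (interval i (suc m)) f ≡ ∑ (interval i m) f + f (i ℕ.+ m)
∑-interval-last i zero f = begin
  f i + 0ℚ        ≡⟨ +-identityʳ (f i) ⟩
  f i             ≡⟨ sym (+-identityˡ (f i)) ⟩
  0ℚ + f i        ≡⟨ cong (λ z → 0ℚ + f z) (sym (ℕₚ.+-identityʳ i)) ⟩
  0ℚ + f (i ℕ.+ 0) ∎
∑-interval-last i (suc m) f = begin
  f i + ∑ (interval (suc i) (suc m)) f               ≡⟨ cong (f i +_) (∑-interval-last (suc i) m f) ⟩
  f i + (∑ (interval (suc i) m) f + f (suc i ℕ.+ m)) ≡⟨ sym (+-assoc (f i) _ _) ⟩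
  f i + ∑ (interval (suc i) m) f + f (suc i ℕ.+ m)   ≡⟨ cong (λ z → f i + ∑ (interval (suc i) m) f + f z) (sym (ℕₚ.+-suc i m)) ⟩
  f i + ∑ (interval (suc i) m) f + f (i ℕ.+ suc m)   ∎

χ-count-pull : ∀ c j (f : ℕ → ℚ) X → χ (c ≡ᵇ j) * (f c * X) ≡ f j * (χ (c ≡ᵇ j) * X)
χ-count-pull c j f X with c ≡ᵇ j in e
... | true rewrite ℕₚ.≡ᵇ⇒≡ c j (Equivalence.from Boolₚ.T-≡ e) = solve 2 (λ p x → con 1ℚ :* (p :* x) := p :* (con 1ℚ :* x)) refl (f j) X
  where open +-*-Solver
... | false = trans (*-zeroˡ (f c * X)) (sym (trans (cong (f j *_) (*-zeroˡ X)) (*-zeroʳ (f j))))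

∑-by-size : ∀ N (g : ℕ → ℚ) (w : Mask N → ℚ)
  → ∑ (allVecs N) (λ A → g (count A) * w A) ≡ ∑ (interval 0 (suc N)) (λ j → g j * ∑ (allVecs N) (λ A → χ (count A ≡ᵇ j) * w A))
∑-by-size N g w = sym (begin
  ∑ R (λ j → g j * ∑ (allVecs N) (λ A → χ (count A ≡ᵇ j) * w A))   ≡⟨ ∑-cong R (λ j → *-distribˡ-∑ (g j) (allVecs N) _) ⟩
  ∑ R (λ j → ∑ (allVecs N) (λ A → g j * (χ (count A ≡ᵇ j) * w A))) ≡⟨ ∑-swap R (allVecs N) _ ⟩
  ∑ (allVecs N) (λ A → ∑ R (λ j → g j * (χ (count A ≡ᵇ j) * w A))) ≡⟨ ∑-cong (allVecs N) only-size ⟩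
  ∑ (allVecs N) (λ A → g (count A) * (χ (count A ≡ᵇ count A) * w A)) ≡⟨ ∑-cong (allVecs N) (λ A → cong (λ b → g (count A) * (χ b * w A)) (Equivalence.to Boolₚ.T-≡ (ℕₚ.≡⇒≡ᵇ (count A) (count A) refl))) ⟩
  ∑ (allVecs N) (λ A → g (count A) * (1ℚ * w A))                   ≡⟨ ∑-cong (allVecs N) (λ A → cong (g (count A) *_) (*-identityˡ (w A))) ⟩
  ∑ (allVecs N) (λ A → g (count A) * w A)                          ∎)
  where
  R = interval 0 (suc N)
  only-size : ∀ A → ∑ R (λ j → g j * (χ (count A ≡ᵇ j) * w A)) ≡ g (count A) * (χ (count A ≡ᵇ count A) * w A)
  only-size A = ∑-single R (interval-unique 0 (suc N)) (count A) (∈-interval⁺ 0 (suc N) (count A) z≤n (s≤s (count≤n A))) _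
    λ {j} _ j≢ → vanish (count A ≡ᵇ j) λ e → j≢ (sym (ℕₚ.≡ᵇ⇒≡ (count A) j (Equivalence.from Boolₚ.T-≡ e)))
    where
    vanish : ∀ b {j} → (b ≡ true → ⊥) → g j * (χ b * w A) ≡ 0ℚ
    vanish true ¬b = ⊥-elim (¬b refl)
    vanish false _ = trans (cong (g _ *_) (*-zeroˡ (w A))) (*-zeroʳ (g _))

∑-χ-count≡C : ∀ N k → ∑ (allVecs N) (λ A → χ (count A ≡ᵇ k)) ≡ ℕtoℚ (N C k)
∑-χ-count≡C zero zero = refl
∑-χ-count≡C zero (suc k) = refl
∑-χ-count≡C (suc N) k = trans (∑-allVecs-suc N _) (pascal k)
  where
  pascal : ∀ k → ∑ (allVecs N) (λ A → χ (count A ≡ᵇ k)) + ∑ (allVecs N) (λ A → χ (suc (count A) ≡ᵇ k)) ≡ ℕtoℚ (suc N C k)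
  pascal zero = trans (cong₂ _+_ (∑-χ-count≡C N zero) (∑-zero (allVecs N))) (+-identityʳ _)
  pascal (suc k) = begin
    ∑ (allVecs N) (λ A → χ (count A ≡ᵇ suc k)) + ∑ (allVecs N) (λ A → χ (count A ≡ᵇ k)) ≡⟨ cong₂ _+_ (∑-χ-count≡C N (suc k)) (∑-χ-count≡C N k) ⟩
    ℕtoℚ (N C suc k) + ℕtoℚ (N C k)                                                    ≡⟨ +-comm (ℕtoℚ (N C suc k)) (ℕtoℚ (N C k)) ⟩
    ℕtoℚ (N C k) + ℕtoℚ (N C suc k)                                                    ≡⟨ sym (ℕtoℚ-+ (N C k) (N C suc k)) ⟩
    ℕtoℚ (N C k ℕ.+ N C suc k)                                                         ≡⟨ cong ℕtoℚ (nCk+nC[k+1]≡[n+1]C[k+1] N k) ⟩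
    ℕtoℚ (suc N C suc k)                                                               ∎

module Weights (u y : ℚ) where

  -- Weight of an edge s → t, from the ranks of s and t: y for an ascent, u y for a descent,
  -- and 0 for a loop, so that loops are weighed out.
  edgeWeight : ℕ → ℕ → ℚ
  edgeWeight zero zero = 0ℚ
  edgeWeight zero (suc t) = y
  edgeWeight (suc s) zero = u * y
  edgeWeight (suc s) (suc t) = edgeWeight s t

  edgeWeight-ascent : ∀ {s t} → s < t → edgeWeight s t ≡ y
  edgeWeight-ascent {zero} {suc t} _ = refl
  edgeWeight-ascent {suc s} {suc t} (s≤s lt) = edgeWeight-ascent lt

  edgeWeight-descent : ∀ {s t} → t < s → edgeWeight s t ≡ u * y
  edgeWeight-descent {suc s} {zero} _ = refl
  edgeWeight-descent {suc s} {suc t} (s≤s lt) = edgeWeight-descent lt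

  edgeWeight-loop : ∀ s → edgeWeight s s ≡ 0ℚ
  edgeWeight-loop zero = refl
  edgeWeight-loop (suc s) = edgeWeight-loop s

  arcWeight : ∀ {n} → Fin n → Fin n → Bool → ℚ
  arcWeight s t false = 1ℚ
  arcWeight s t true = edgeWeight (toℕ s) (toℕ t)

  weight : ∀ {n} → Digraph n → ℚ
  weight {n} D = ∏ (allFin n) λ s → ∏ (allFin n) λ t → arcWeight s t (edge D s t)

  arcWeight-mono : ∀ {k n} (e : Fin k → Fin n) → (∀ a b → toℕ a < toℕ b → toℕ (e a) < toℕ (e b))
    → ∀ a b x → arcWeight (e a) (e b) x ≡ arcWeight a b x
  arcWeight-mono e mono a b false = refl
  arcWeight-mono e mono a b true with ℕₚ.<-cmp (toℕ a) (toℕ b)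
  ... | tri< lt _ _ = trans (edgeWeight-ascent (mono a b lt)) (sym (edgeWeight-ascent lt))
  ... | tri≈ _ eq _ rewrite Finₚ.toℕ-injective eq = trans (edgeWeight-loop (toℕ (e b))) (sym (edgeWeight-loop (toℕ b)))
  ... | tri> _ _ gt = trans (edgeWeight-descent (mono b a gt)) (sym (edgeWeight-descent gt))

  module _ {n : ℕ} (A : Mask n) where
    open Decomposition A

    crossWeight₁₂ : Matrix k m → ℚ
    crossWeight₁₂ X = ∏ (allFin k) λ a → ∏ (allFin m) λ b → arcWeight (j₁ a) (j₂ b) (lookup (lookup X a) b)

    crossWeight₂₁ : Matrix m k → ℚ
    crossWeight₂₁ Y = ∏ (allFin m) λ b → ∏ (allFin k) λ a → arcWeight (j₂ b) (j₁ a) (lookup (lookup Y b) a)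

    weight-assemble : ∀ D₁ D₂ X Y → weight (assemble (D₁ , D₂ , X , Y))
      ≡ weight D₁ * weight D₂ * crossWeight₁₂ X * crossWeight₂₁ Y
    weight-assemble D₁ D₂ X Y = begin
      weight P
        ≡⟨ ∏-split A _ ⟩
      ∏ (allFin k) (λ a → ∏ (allFin n) (w (j₁ a))) * ∏ (allFin m) (λ b → ∏ (allFin n) (w (j₂ b)))
        ≡⟨ cong₂ _*_ (∏-cong (allFin k) (λ a → ∏-split A (w (j₁ a)))) (∏-cong (allFin m) (λ b → ∏-split A (w (j₂ b)))) ⟩
      ∏ (allFin k) (λ a → ∏ (allFin k) (λ a′ → w (j₁ a) (j₁ a′)) * ∏ (allFin m) (λ b → w (j₁ a) (j₂ b)))
        * ∏ (allFin m) (λ b → ∏ (allFin k) (λ a → w (j₂ b) (j₁ a)) * ∏ (allFin m) (λ b′ → w (j₂ b) (j₂ b′)))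
        ≡⟨ cong₂ _*_ (∏-distrib-* (allFin k) _ _) (∏-distrib-* (allFin m) _ _) ⟩
      (∏ (allFin k) (λ a → ∏ (allFin k) (λ a′ → w (j₁ a) (j₁ a′))) * ∏ (allFin k) (λ a → ∏ (allFin m) (λ b → w (j₁ a) (j₂ b))))
        * (∏ (allFin m) (λ b → ∏ (allFin k) (λ a → w (j₂ b) (j₁ a))) * ∏ (allFin m) (λ b → ∏ (allFin m) (λ b′ → w (j₂ b) (j₂ b′))))
        ≡⟨ cong₂ _*_ (cong₂ _*_ (block D₁ inj₁ (join-mono₁ A) λ _ _ → refl) cross₁₂) (cong₂ _*_ cross₂₁ (block D₂ inj₂ (join-mono₂ A) λ _ _ → refl)) ⟩
      (weight D₁ * crossWeight₁₂ X) * (crossWeight₂₁ Y * weight D₂)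
        ≡⟨ solve 4 (λ a b c d → (a :* c) :* (d :* b) := a :* b :* c :* d) refl (weight D₁) (weight D₂) (crossWeight₁₂ X) (crossWeight₂₁ Y) ⟩
      weight D₁ * weight D₂ * crossWeight₁₂ X * crossWeight₂₁ Y ∎
      where
      open +-*-Solver
      q = (D₁ , D₂ , X , Y)
      P = assemble q
      w : Fin n → Fin n → ℚ
      w i j = arcWeight i j (edge P i j)
      block : ∀ {r} (Dᵢ : Digraph r) (ι : Fin r → Part A) → (∀ a b → toℕ a < toℕ b → toℕ (join A (ι a)) < toℕ (join A (ι b)))
        → (∀ a b → entry q (ι a) (ι b) ≡ edge Dᵢ a b)
        → ∏ (allFin r) (λ a → ∏ (allFin r) (λ a′ → w (join A (ι a)) (join A (ι a′)))) ≡ weight Dᵢ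
      block {r} Dᵢ ι mono same = ∏-cong (allFin r) λ a → ∏-cong (allFin r) λ a′ →
        trans (cong (arcWeight _ _) (trans (edge-assemble-join q (ι a) (ι a′)) (same a a′)))
              (arcWeight-mono (join A ∘ ι) mono a a′ (edge Dᵢ a a′))
      cross₁₂ : ∏ (allFin k) (λ a → ∏ (allFin m) (λ b → w (j₁ a) (j₂ b))) ≡ crossWeight₁₂ X
      cross₁₂ = ∏-cong (allFin k) λ a → ∏-cong (allFin m) λ b → cong (arcWeight (j₁ a) (j₂ b)) (edge-assemble-join q (inj₁ a) (inj₂ b))
      cross₂₁ : ∏ (allFin m) (λ b → ∏ (allFin k) (λ a → w (j₂ b) (j₁ a))) ≡ crossWeight₂₁ Y
      cross₂₁ = ∏-cong (allFin m) λ b → ∏-cong (allFin k) λ a → cong (arcWeight (j₂ b) (j₁ a)) (edge-assemble-join q (inj₂ b) (inj₁ a))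

  α β : ℚ
  α = 1ℚ + y
  β = 1ℚ + u * y

  ∑-weight : ∀ m → ∑ (allDigraphs m) weight ≡ α ^ (m C 2) * β ^ (m C 2)
  ∑-weight m = trans (∑-∏-matrices m m arcWeight) (∏-rows m)
    where
    open +-*-Solver
    -- Vertex 0 contributes an ascent to every later vertex and a descent from it.
    ∏-rows : ∀ m → ∏ (allFin m) (λ i → ∏ (allFin m) (λ j → 1ℚ + edgeWeight (toℕ i) (toℕ j))) ≡ α ^ (m C 2) * β ^ (m C 2)
    ∏-rows zero = refl
    ∏-rows (suc m) = begin
      ∏ (allFin (suc m)) (λ i → ∏ (allFin (suc m)) (λ j → 1ℚ + edgeWeight (toℕ i) (toℕ j)))
        ≡⟨ ∏-allFin-suc m (λ i → ∏ (allFin (suc m)) (λ j → 1ℚ + edgeWeight (toℕ i) (toℕ j))) ⟩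
      ∏ (allFin (suc m)) (λ j → 1ℚ + edgeWeight 0 (toℕ j)) * ∏ (allFin m) (λ i → ∏ (allFin (suc m)) (λ j → 1ℚ + edgeWeight (suc (toℕ i)) (toℕ j)))
        ≡⟨ cong₂ _*_ (∏-allFin-suc m (λ j → 1ℚ + edgeWeight 0 (toℕ j)))
                     (∏-cong (allFin m) (λ i → ∏-allFin-suc m (λ j → 1ℚ + edgeWeight (suc (toℕ i)) (toℕ j)))) ⟩
      ((1ℚ + 0ℚ) * ∏ (allFin m) (λ _ → α)) * ∏ (allFin m) (λ i → β * ∏ (allFin m) (λ j → 1ℚ + edgeWeight (toℕ i) (toℕ j)))
        ≡⟨ cong₂ _*_ (trans (*-identityˡ _) (∏-const m α)) (∏-distrib-* (allFin m) (λ _ → β) _) ⟩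
      α ^ m * (∏ (allFin m) (λ _ → β) * ∏ (allFin m) (λ i → ∏ (allFin m) (λ j → 1ℚ + edgeWeight (toℕ i) (toℕ j))))
        ≡⟨ cong₂ (λ p r → α ^ m * (p * r)) (∏-const m β) (∏-rows m) ⟩
      α ^ m * (β ^ m * (α ^ (m C 2) * β ^ (m C 2)))
        ≡⟨ solve 4 (λ p q r s → p :* (q :* (r :* s)) := (p :* r) :* (q :* s)) refl (α ^ m) (β ^ m) (α ^ (m C 2)) (β ^ (m C 2)) ⟩
      (α ^ m * α ^ (m C 2)) * (β ^ m * β ^ (m C 2))
        ≡⟨ cong₂ _*_ (sym (^-+ α m (m C 2))) (sym (^-+ β m (m C 2))) ⟩
      α ^ (m ℕ.+ m C 2) * β ^ (m ℕ.+ m C 2)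
        ≡⟨ cong (λ z → α ^ z * β ^ z) (trans (cong (ℕ._+ m C 2) (sym (nC1≡n m))) (nCk+nC[k+1]≡[n+1]C[k+1] m 1)) ⟩
      α ^ (suc m C 2) * β ^ (suc m C 2) ∎

  crossFactor : ∀ {n} → Mask n → ℚ
  crossFactor A = ∏ (allFin (count A)) λ a → ∏ (allFin (count∁ A)) λ b →
    1ℚ + edgeWeight (toℕ (join A (inj₁ a))) (toℕ (join A (inj₂ b)))

  ∑-crossWeight₁₂ : ∀ {n} (A : Mask n) → ∑ (allMatrices (count A) (count∁ A)) (crossWeight₁₂ A) ≡ crossFactor A
  ∑-crossWeight₁₂ A = ∑-∏-matrices (count A) (count∁ A) λ a b → arcWeight (join A (inj₁ a)) (join A (inj₂ b))

  crossFactor-inside : ∀ {n} (A : Mask n) → crossFactor (true ∷ A) ≡ α ^ count∁ A * crossFactor A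
  crossFactor-inside A = trans (∏-allFin-suc (count A) (λ a → ∏ (allFin (count∁ A)) λ b →
    1ℚ + edgeWeight (toℕ (join (true ∷ A) (inj₁ a))) (toℕ (join (true ∷ A) (inj₂ b))))) (cong (_* crossFactor A) (∏-const (count∁ A) α))

  crossFactor-outside : ∀ {n} (A : Mask n) → crossFactor (false ∷ A) ≡ β ^ count A * crossFactor A
  crossFactor-outside A = trans (∏-cong (allFin (count A)) (λ a → ∏-allFin-suc (count∁ A) λ b →
    1ℚ + edgeWeight (toℕ (join (false ∷ A) (inj₁ a))) (toℕ (join (false ∷ A) (inj₂ b)))))
    (trans (∏-distrib-* (allFin (count A)) (λ _ → β) _) (cong (_* crossFactor A) (∏-const (count A) β)))

  -- Summing the cross factor over the k-subsets of [N] is the q-Pascal recursion in disguise.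
  ∑-crossFactor : ∀ q → β ≡ q * α → ∀ N k
    → ∑ (allVecs N) (λ A → χ (count A ≡ᵇ k) * crossFactor A) ≡ α ^ (k ℕ.* (N ∸ k)) * qbinom q N k
  ∑-crossFactor q β≡qα zero zero = refl
  ∑-crossFactor q β≡qα zero (suc k) = sym (*-zeroʳ (α ^ (suc k ℕ.* 0)))
  ∑-crossFactor q β≡qα (suc N) zero = begin
    ∑ (allVecs (suc N)) (λ A → χ (count A ≡ᵇ 0) * crossFactor A)
      ≡⟨ ∑-allVecs-suc N _ ⟩
    ∑ (allVecs N) (λ A → χ (count A ≡ᵇ 0) * crossFactor (false ∷ A)) + ∑ (allVecs N) (λ A → 0ℚ * crossFactor (true ∷ A))
      ≡⟨ cong₂ _+_ (∑-cong (allVecs N) λ A → trans (cong (χ (count A ≡ᵇ 0) *_) (crossFactor-outside A)) (χ-count-pull (count A) 0 (β ^_) _))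
                   (trans (∑-cong (allVecs N) λ A → *-zeroˡ (crossFactor (true ∷ A))) (∑-zero (allVecs N))) ⟩
    ∑ (allVecs N) (λ A → 1ℚ * (χ (count A ≡ᵇ 0) * crossFactor A)) + 0ℚ
      ≡⟨ trans (+-identityʳ _) (∑-cong (allVecs N) λ A → *-identityˡ _) ⟩
    ∑ (allVecs N) (λ A → χ (count A ≡ᵇ 0) * crossFactor A)
      ≡⟨ ∑-crossFactor q β≡qα N 0 ⟩
    1ℚ * 1ℚ ∎
  ∑-crossFactor q β≡qα (suc N) (suc k) = begin
    ∑ (allVecs (suc N)) (λ A → χ (count A ≡ᵇ suc k) * crossFactor A)
      ≡⟨ ∑-allVecs-suc N _ ⟩
    ∑ (allVecs N) (λ A → χ (count A ≡ᵇ suc k) * crossFactor (false ∷ A)) + ∑ (allVecs N) (λ A → χ (count A ≡ᵇ k) * crossFactor (true ∷ A))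
      ≡⟨ cong₂ _+_ outside inside ⟩
    β ^ suc k * ∑ (allVecs N) (λ A → χ (count A ≡ᵇ suc k) * crossFactor A) + α ^ (N ∸ k) * ∑ (allVecs N) (λ A → χ (count A ≡ᵇ k) * crossFactor A)
      ≡⟨ cong₂ (λ s t → β ^ suc k * s + α ^ (N ∸ k) * t) (∑-crossFactor q β≡qα N (suc k)) (∑-crossFactor q β≡qα N k) ⟩
    β ^ suc k * (α ^ (suc k ℕ.* (N ∸ suc k)) * qbinom q N (suc k)) + α ^ (N ∸ k) * (α ^ (k ℕ.* (N ∸ k)) * qbinom q N k)
      ≡⟨ cong₂ _+_ (new-inside (ℕₚ.<-cmp k N)) (trans (sym (*-assoc (α ^ (N ∸ k)) (α ^ (k ℕ.* (N ∸ k))) (qbinom q N k))) (cong (_* qbinom q N k) (sym (^-+ α (N ∸ k) (k ℕ.* (N ∸ k)))))) ⟩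
    α ^ (suc k ℕ.* (N ∸ k)) * (q ^ suc k * qbinom q N (suc k)) + α ^ (suc k ℕ.* (N ∸ k)) * qbinom q N k
      ≡⟨ solve 3 (λ p r s → p :* r :+ p :* s := p :* (s :+ r)) refl (α ^ (suc k ℕ.* (N ∸ k))) (q ^ suc k * qbinom q N (suc k)) (qbinom q N k) ⟩
    α ^ (suc k ℕ.* (N ∸ k)) * (qbinom q N k + q ^ suc k * qbinom q N (suc k)) ∎
    where
    open +-*-Solver
    outside : ∑ (allVecs N) (λ A → χ (count A ≡ᵇ suc k) * crossFactor (false ∷ A))
              ≡ β ^ suc k * ∑ (allVecs N) (λ A → χ (count A ≡ᵇ suc k) * crossFactor A)
    outside = trans (∑-cong (allVecs N) λ A → trans (cong (χ (count A ≡ᵇ suc k) *_) (crossFactor-outside A))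
                                                      (χ-count-pull (count A) (suc k) (β ^_) _))
                    (sym (*-distribˡ-∑ (β ^ suc k) (allVecs N) _))
    inside : ∑ (allVecs N) (λ A → χ (count A ≡ᵇ k) * crossFactor (true ∷ A))
             ≡ α ^ (N ∸ k) * ∑ (allVecs N) (λ A → χ (count A ≡ᵇ k) * crossFactor A)
    inside = trans (∑-cong (allVecs N) λ A → trans (cong (χ (count A ≡ᵇ k) *_)
                                                          (trans (crossFactor-inside A) (cong (λ z → α ^ z * crossFactor A) (count∁≡ A))))
                                                    (χ-count-pull (count A) k (λ c → α ^ (N ∸ c)) _))
                   (sym (*-distribˡ-∑ (α ^ (N ∸ k)) (allVecs N) _))
    both-zero : qbinom q N (suc k) ≡ 0ℚ
      → β ^ suc k * (α ^ (suc k ℕ.* (N ∸ suc k)) * qbinom q N (suc k)) ≡ α ^ (suc k ℕ.* (N ∸ k)) * (q ^ suc k * qbinom q N (suc k))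
    both-zero z rewrite z =
      solve 4 (λ a b c d → a :* (b :* con 0ℚ) := c :* (d :* con 0ℚ)) refl
        (β ^ suc k) (α ^ (suc k ℕ.* (N ∸ suc k))) (α ^ (suc k ℕ.* (N ∸ k))) (q ^ suc k)
    new-inside : Tri (k < N) (k ≡ N) (N < k)
      → β ^ suc k * (α ^ (suc k ℕ.* (N ∸ suc k)) * qbinom q N (suc k)) ≡ α ^ (suc k ℕ.* (N ∸ k)) * (q ^ suc k * qbinom q N (suc k))
    new-inside (tri< lt _ _) = begin
      β ^ suc k * (α ^ (suc k ℕ.* (N ∸ suc k)) * Z)            ≡⟨ cong (λ z → z ^ suc k * (α ^ (suc k ℕ.* (N ∸ suc k)) * Z)) β≡qα ⟩
      (q * α) ^ suc k * (α ^ (suc k ℕ.* (N ∸ suc k)) * Z)      ≡⟨ cong (_* (α ^ (suc k ℕ.* (N ∸ suc k)) * Z)) (^-distrib-* q α (suc k)) ⟩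
      (q ^ suc k * α ^ suc k) * (α ^ (suc k ℕ.* (N ∸ suc k)) * Z)
        ≡⟨ solve 4 (λ p r s z → (p :* r) :* (s :* z) := (r :* s) :* (p :* z)) refl (q ^ suc k) (α ^ suc k) (α ^ (suc k ℕ.* (N ∸ suc k))) Z ⟩
      (α ^ suc k * α ^ (suc k ℕ.* (N ∸ suc k))) * (q ^ suc k * Z) ≡⟨ cong (_* (q ^ suc k * Z)) (sym (^-+ α (suc k) _)) ⟩
      α ^ (suc k ℕ.+ suc k ℕ.* (N ∸ suc k)) * (q ^ suc k * Z)
        ≡⟨ cong (λ e → α ^ e * (q ^ suc k * Z)) (trans (sym (ℕₚ.*-suc (suc k) (N ∸ suc k))) (cong (suc k ℕ.*_) (sym (ℕₚ.+-∸-assoc 1 lt)))) ⟩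
      α ^ (suc k ℕ.* (N ∸ k)) * (q ^ suc k * Z) ∎
      where Z = qbinom q N (suc k)
    new-inside (tri≈ _ k≡N _) = both-zero (qbinom-above q N (suc k) (s≤s (ℕₚ.≤-reflexive (sym k≡N))))
    new-inside (tri> _ _ gt) = both-zero (qbinom-above q N (suc k) (ℕₚ.m<n⇒m<1+n gt))

  ^-sum : ∀ {a} {A : Set a} x (L : List A) (h : A → ℕ) → x ^ sum (map h L) ≡ ∏ L (λ s → x ^ h s)
  ^-sum x [] h = refl
  ^-sum x (s ∷ L) h = trans (^-+ x (h s) _) (cong (x ^ h s *_) (^-sum x L h))

  ^-countℕ : ∀ {a} {A : Set a} x (L : List A) (b : A → Bool) → x ^ countℕ (map b L) ≡ ∏ L (λ t → if b t then x else 1ℚ)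
  ^-countℕ x [] b = refl
  ^-countℕ x (t ∷ L) b with b t
  ... | true = cong (x *_) (^-countℕ x L b)
  ... | false = trans (^-countℕ x L b) (sym (*-identityˡ _))

  desc-weight : ∀ {n} (D : Digraph n) → Loopless D → u ^ des D * y ^ e D ≡ weight D
  desc-weight {n} D loopless = begin
    u ^ des D * y ^ e D
      ≡⟨ cong₂ _*_ (^-sum u (allFin n) _) (^-sum y (allFin n) _) ⟩
    ∏ (allFin n) (λ s → u ^ countℕ (map (isDescent D s) (allFin n))) * ∏ (allFin n) (λ s → y ^ countℕ (map (edge D s) (allFin n)))
      ≡⟨ sym (∏-distrib-* (allFin n) _ _) ⟩
    ∏ (allFin n) (λ s → u ^ countℕ (map (isDescent D s) (allFin n)) * y ^ countℕ (map (edge D s) (allFin n)))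
      ≡⟨ ∏-cong (allFin n) (λ s → trans (cong₂ _*_ (^-countℕ u (allFin n) (isDescent D s)) (^-countℕ y (allFin n) (edge D s)))
           (trans (sym (∏-distrib-* (allFin n) _ _)) (∏-cong (allFin n) (arc s)))) ⟩
    weight D ∎
    where
    arc : ∀ s t → (if isDescent D s t then u else 1ℚ) * (if edge D s t then y else 1ℚ) ≡ arcWeight s t (edge D s t)
    arc s t with toℕ t ℕ.<? toℕ s
    ... | yes t<s with edge D s t
    ...   | true = sym (edgeWeight-descent t<s)
    ...   | false = refl
    arc s t | no t≮s with edge D s t in est
    ...   | false = refl
    ...   | true with ℕₚ.m≤n⇒m<n∨m≡n (ℕₚ.≮⇒≥ t≮s)
    ...     | inj₁ s<t = trans (*-identityˡ y) (sym (edgeWeight-ascent s<t))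
    ...     | inj₂ s≡t with () ← trans (sym est) (trans (cong (edge D s) (Finₚ.toℕ-injective (sym s≡t))) (loopless s))

  weight-loop : ∀ {n} (D : Digraph n) s → edge D s s ≡ true → weight D ≡ 0ℚ
  weight-loop {n} D s loop = ∏-zero (allFin n) (∈-allFin s) (∏-zero (allFin n) (∈-allFin s) (trans (cong (arcWeight s s) loop) (edgeWeight-loop (toℕ s))))
    where
    ∏-zero : ∀ {a} {A : Set a} (L : List A) {f : A → ℚ} {x} → x ∈ L → f x ≡ 0ℚ → ∏ L f ≡ 0ℚ
    ∏-zero (z ∷ L) {f} (here refl) e = trans (cong (_* ∏ L f) e) (*-zeroˡ (∏ L f))
    ∏-zero (z ∷ L) {f} (there m) e = trans (cong (f z *_) (∏-zero L m e)) (*-zeroʳ (f z))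

  StrongOn-full⇔StronglyConnected : ∀ {n} (D : Digraph n) → StrongOn D full ⇔ StronglyConnected D
  StrongOn-full⇔StronglyConnected D = mk⇔ (λ sc a b → from-full (sc a b (full∋ a) (full∋ b))) (λ sc a b _ _ → to-full (sc a b))
    where
    from-full : ∀ {a b} → PathWithin D full a b → Path D a b
    from-full here = here
    from-full (step p e _) = step (from-full p) e
    to-full : ∀ {a b} → Path D a b → PathWithin D full a b
    to-full here = here
    to-full (step {c = c} p e) = step (to-full p) e (full∋ c)

  Loopless? : ∀ {n} (D : Digraph n) → Dec (Loopless D)
  Loopless? D = Finₚ.all? λ s → edge D s s Bool.≟ false

  -- Digraphs with a loop have weight 0, so they may be added to the sum for free.
  weightSum≡∑-StrongOn : ∀ k (L : List (Digraph k)) → Unique L → (∀ D → (D ∈ L) ⇔ (Loopless D × StronglyConnected D))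
    → weightSum u y L ≡ ∑ (allDigraphs k) (λ D → χ (does (StrongOn? D full)) * weight D)
  weightSum≡∑-StrongOn k L uL mem = begin
    weightSum u y L
      ≡⟨ sumℚ-map L _ ⟩
    ∑ L (λ D → u ^ des D * y ^ e D)
      ≡⟨ ∑-cong-∈ L (λ {D} D∈L → trans (desc-weight D (proj₁ (to (mem D) D∈L))) (sym (*-identityˡ _))) ⟩
    ∑ L (λ D → χ true * weight D)
      ≡⟨ ∑-bij-restricted L (allDigraphs k) uL (allMatrices-unique k k) id (λ _ → yes tt) (λ D → Loopless? D ×-dec StrongOn? D full) weight
           (λ {D} D∈L _ → let (ll , sc) = to (mem D) D∈L in allMatrices-complete k k D , ll , from (StrongOn-full⇔StronglyConnected D) sc)
           (λ _ _ _ _ e → e)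
           (λ {D} _ (ll , sc) → D , from (mem D) (ll , to (StrongOn-full⇔StronglyConnected D) sc) , tt , refl) ⟩
    ∑ (allDigraphs k) (λ D → χ (does (Loopless? D ×-dec StrongOn? D full)) * weight D)
      ≡⟨ ∑-cong (allDigraphs k) (λ D → drop-loopless (Loopless? D) (StrongOn? D full)) ⟩
    ∑ (allDigraphs k) (λ D → χ (does (StrongOn? D full)) * weight D) ∎
    where
    open Equivalence
    drop-loopless : ∀ {D : Digraph k} (ll? : Dec (Loopless D)) (sc? : Dec (StrongOn D full))
      → χ (does (ll? ×-dec sc?)) * weight D ≡ χ (does sc?) * weight D
    drop-loopless (yes _) _ = refl
    drop-loopless {D} (no ¬ll) sc? with Finₚ.¬∀⟶∃¬ k _ (λ s → edge D s s Bool.≟ false) ¬ll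
    ... | s , ¬false = trans (*-zeroˡ (weight D)) (sym (trans (cong (χ (does sc?) *_) (weight-loop D s (Boolₚ.¬-not ¬false))) (*-zeroʳ (χ (does sc?)))))

  etaSum strongSum : ℕ → ℚ
  etaSum j = ∑ (allDigraphs j) (λ D → η D full * weight D)
  strongSum j = ∑ (allDigraphs j) (λ D → χ (does (StrongOn? D full)) * weight D)

module Factorisation (u y : ℚ) {n : ℕ} (A : Mask n) where
  open Weights u y
  open Decomposition A

  _≟ᴹ_ : ∀ {r c} (M N : Matrix r c) → Dec (M ≡ N)
  _≟ᴹ_ = Vecₚ.≡-dec (Vecₚ.≡-dec Bool._≟_)

  crossWeight₁₂-zero : crossWeight₁₂ A (zeroMatrix k m) ≡ 1ℚ
  crossWeight₁₂-zero = trans (∏-cong (allFin k) λ a → trans (∏-cong (allFin m) λ b → cong (arcWeight (j₁ a) (j₂ b)) (lookup-zeroMatrix a b)) (∏-one m)) (∏-one k)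

  crossWeight₂₁-zero : crossWeight₂₁ A (zeroMatrix m k) ≡ 1ℚ
  crossWeight₂₁-zero = trans (∏-cong (allFin m) λ b → trans (∏-cong (allFin k) λ a → cong (arcWeight (j₂ b) (j₁ a)) (lookup-zeroMatrix b a)) (∏-one k)) (∏-one m)

  ∑-χ-zeroMatrix : ∀ {r c} (W : Matrix r c → ℚ) → ∑ (allMatrices r c) (λ M → χ (does (M ≟ᴹ zeroMatrix r c)) * W M) ≡ W (zeroMatrix r c)
  ∑-χ-zeroMatrix {r} {c} W = trans (∑-single (allMatrices r c) (allMatrices-unique r c) (zeroMatrix r c) (allMatrices-complete r c _) _
    (λ {M} _ M≢0 → χ-zero (M ≟ᴹ zeroMatrix r c) (W M) M≢0))
    (trans (cong (λ b → χ b * W (zeroMatrix r c)) (dec-true (zeroMatrix r c ≟ᴹ zeroMatrix r c) refl)) (*-identityˡ _))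

  ∑⁴-product : ∀ {a b c d} {A₁ : Set a} {A₂ : Set b} {A₃ : Set c} {A₄ : Set d}
    (L₁ : List A₁) (L₂ : List A₂) (L₃ : List A₃) (L₄ : List A₄) (f₁ : A₁ → ℚ) (f₂ : A₂ → ℚ) (f₃ : A₃ → ℚ) (f₄ : A₄ → ℚ)
    → ∑ L₁ (λ x₁ → ∑ L₂ λ x₂ → ∑ L₃ λ x₃ → ∑ L₄ λ x₄ → f₁ x₁ * (f₂ x₂ * (f₃ x₃ * f₄ x₄)))
      ≡ ∑ L₁ f₁ * (∑ L₂ f₂ * (∑ L₃ f₃ * ∑ L₄ f₄))
  ∑⁴-product L₁ L₂ L₃ L₄ f₁ f₂ f₃ f₄ = begin
    ∑ L₁ (λ x₁ → ∑ L₂ λ x₂ → ∑ L₃ λ x₃ → ∑ L₄ λ x₄ → f₁ x₁ * (f₂ x₂ * (f₃ x₃ * f₄ x₄)))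
      ≡⟨ ∑-cong L₁ (λ x₁ → ∑-cong L₂ λ x₂ → ∑-cong L₃ λ x₃ → sym (*-distribˡ-∑ (f₁ x₁) L₄ _)) ⟩
    ∑ L₁ (λ x₁ → ∑ L₂ λ x₂ → ∑ L₃ λ x₃ → f₁ x₁ * ∑ L₄ λ x₄ → f₂ x₂ * (f₃ x₃ * f₄ x₄))
      ≡⟨ ∑-cong L₁ (λ x₁ → ∑-cong L₂ λ x₂ → sym (*-distribˡ-∑ (f₁ x₁) L₃ _)) ⟩
    ∑ L₁ (λ x₁ → ∑ L₂ λ x₂ → f₁ x₁ * ∑ L₃ λ x₃ → ∑ L₄ λ x₄ → f₂ x₂ * (f₃ x₃ * f₄ x₄))
      ≡⟨ ∑-cong L₁ (λ x₁ → sym (*-distribˡ-∑ (f₁ x₁) L₂ _)) ⟩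
    ∑ L₁ (λ x₁ → f₁ x₁ * ∑ L₂ λ x₂ → ∑ L₃ λ x₃ → ∑ L₄ λ x₄ → f₂ x₂ * (f₃ x₃ * f₄ x₄))
      ≡⟨ sym (*-distribʳ-∑ _ L₁ f₁) ⟩
    ∑ L₁ f₁ * ∑ L₂ (λ x₂ → ∑ L₃ λ x₃ → ∑ L₄ λ x₄ → f₂ x₂ * (f₃ x₃ * f₄ x₄))
      ≡⟨ cong (∑ L₁ f₁ *_) (∑-cong L₂ λ x₂ → trans (∑-cong L₃ λ x₃ → sym (*-distribˡ-∑ (f₂ x₂) L₄ _)) (sym (*-distribˡ-∑ (f₂ x₂) L₃ _))) ⟩
    ∑ L₁ f₁ * ∑ L₂ (λ x₂ → f₂ x₂ * ∑ L₃ λ x₃ → ∑ L₄ λ x₄ → f₃ x₃ * f₄ x₄)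
      ≡⟨ cong (∑ L₁ f₁ *_) (sym (*-distribʳ-∑ _ L₂ f₂)) ⟩
    ∑ L₁ f₁ * (∑ L₂ f₂ * ∑ L₃ λ x₃ → ∑ L₄ λ x₄ → f₃ x₃ * f₄ x₄)
      ≡⟨ cong (λ z → ∑ L₁ f₁ * (∑ L₂ f₂ * z)) (∑-product L₃ L₄ f₃ f₄) ⟩
    ∑ L₁ f₁ * (∑ L₂ f₂ * (∑ L₃ f₃ * ∑ L₄ f₄)) ∎

  χ-×-dec : ∀ {p q} {P : Set p} {Q : Set q} (d₁ : Dec P) (d₂ : Dec Q) → χ (does (d₁ ×-dec d₂)) ≡ χ (does d₁) * χ (does d₂)
  χ-×-dec (yes _) (yes _) = refl
  χ-×-dec (yes _) (no _) = refl
  χ-×-dec (no _) (yes _) = refl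
  χ-×-dec (no _) (no _) = refl

  χ-cong₃ : ∀ {b₁ b₂ : Bool} {x₁ x₂ z₁ z₂ : ℚ} → b₁ ≡ b₂ → x₁ ≡ x₂ → z₁ ≡ z₂ → χ b₁ * (x₁ * z₁) ≡ χ b₂ * (x₂ * z₂)
  χ-cong₃ refl refl refl = refl

  -- A is in-closed exactly when the block of edges into A is empty; the digraph on A then carries η.
  ∑-InClosed-factor : ∑ (allDigraphs n) (λ P → χ (does (InClosed? P A)) * (η P A * weight P)) ≡ etaSum k * (∑ (allDigraphs m) weight * crossFactor A)
  ∑-InClosed-factor = begin
    ∑ (allDigraphs n) F
      ≡⟨ ∑-allDigraphs-blocks F ⟩
    ∑ (allDigraphs k) (λ D₁ → ∑ (allDigraphs m) λ D₂ → ∑ (allMatrices k m) λ X → ∑ (allMatrices m k) λ Y → F (assemble (D₁ , D₂ , X , Y)))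
      ≡⟨ ∑-cong (allDigraphs k) (λ D₁ → ∑-cong (allDigraphs m) λ D₂ → ∑-cong (allMatrices k m) λ X → ∑-cong (allMatrices m k) λ Y → term D₁ D₂ X Y) ⟩
    ∑ (allDigraphs k) (λ D₁ → ∑ (allDigraphs m) λ D₂ → ∑ (allMatrices k m) λ X → ∑ (allMatrices m k) λ Y →
        (η D₁ full * weight D₁) * (weight D₂ * (crossWeight₁₂ A X * (χ (does (Y ≟ᴹ zeroMatrix m k)) * crossWeight₂₁ A Y))))
      ≡⟨ ∑⁴-product (allDigraphs k) (allDigraphs m) (allMatrices k m) (allMatrices m k) _ _ _ _ ⟩
    etaSum k * (∑ (allDigraphs m) weight * (∑ (allMatrices k m) (crossWeight₁₂ A) * ∑ (allMatrices m k) λ Y → χ (does (Y ≟ᴹ zeroMatrix m k)) * crossWeight₂₁ A Y))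
      ≡⟨ cong₂ (λ s t → etaSum k * (∑ (allDigraphs m) weight * (s * t))) (∑-crossWeight₁₂ A) (trans (∑-χ-zeroMatrix (crossWeight₂₁ A)) crossWeight₂₁-zero) ⟩
    etaSum k * (∑ (allDigraphs m) weight * (crossFactor A * 1ℚ))
      ≡⟨ cong (λ z → etaSum k * (∑ (allDigraphs m) weight * z)) (*-identityʳ (crossFactor A)) ⟩
    etaSum k * (∑ (allDigraphs m) weight * crossFactor A) ∎
    where
    F : Digraph n → ℚ
    F P = χ (does (InClosed? P A)) * (η P A * weight P)
    term : ∀ D₁ D₂ X Y → F (assemble (D₁ , D₂ , X , Y))
      ≡ (η D₁ full * weight D₁) * (weight D₂ * (crossWeight₁₂ A X * (χ (does (Y ≟ᴹ zeroMatrix m k)) * crossWeight₂₁ A Y)))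
    term D₁ D₂ X Y = begin
      χ (does (InClosed? P A)) * (η P A * weight P)
        ≡⟨ χ-cong₃ (does-⇔ InClosed⇔no-edges-in (InClosed? P A) (Y ≟ᴹ zeroMatrix m k)) η-inside (weight-assemble A D₁ D₂ X Y) ⟩
      χ (does (Y ≟ᴹ zeroMatrix m k)) * (η D₁ full * (weight D₁ * weight D₂ * crossWeight₁₂ A X * crossWeight₂₁ A Y))
        ≡⟨ solve 6 (λ i e g₁ g₂ wx wy → i :* (e :* (g₁ :* g₂ :* wx :* wy)) := (e :* g₁) :* (g₂ :* (wx :* (i :* wy)))) refl
             (χ (does (Y ≟ᴹ zeroMatrix m k))) (η D₁ full) (weight D₁) (weight D₂) (crossWeight₁₂ A X) (crossWeight₂₁ A Y) ⟩
      (η D₁ full * weight D₁) * (weight D₂ * (crossWeight₁₂ A X * (χ (does (Y ≟ᴹ zeroMatrix m k)) * crossWeight₂₁ A Y))) ∎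
      where
      open +-*-Solver
      open Assembled (D₁ , D₂ , X , Y) using (P; η-inside; InClosed⇔no-edges-in)

  -- A is a detached strongly connected block of the whole vertex set exactly when both cross blocks
  -- are empty and the digraph on A is strongly connected; the complement then carries η.
  ∑-Block-factor : (v : Fin n) → A ∋ v
    → ∑ (allDigraphs n) (λ P → χ (does (Block? P full v A)) * (η P (full ∖ A) * weight P)) ≡ strongSum k * etaSum m
  ∑-Block-factor v av = begin
    ∑ (allDigraphs n) F
      ≡⟨ ∑-allDigraphs-blocks F ⟩
    ∑ (allDigraphs k) (λ D₁ → ∑ (allDigraphs m) λ D₂ → ∑ (allMatrices k m) λ X → ∑ (allMatrices m k) λ Y → F (assemble (D₁ , D₂ , X , Y)))
      ≡⟨ ∑-cong (allDigraphs k) (λ D₁ → ∑-cong (allDigraphs m) λ D₂ → ∑-cong (allMatrices k m) λ X → ∑-cong (allMatrices m k) λ Y → term D₁ D₂ X Y) ⟩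
    ∑ (allDigraphs k) (λ D₁ → ∑ (allDigraphs m) λ D₂ → ∑ (allMatrices k m) λ X → ∑ (allMatrices m k) λ Y →
        (χ (does (StrongOn? D₁ full)) * weight D₁) * ((η D₂ full * weight D₂)
          * ((χ (does (X ≟ᴹ zeroMatrix k m)) * crossWeight₁₂ A X) * (χ (does (Y ≟ᴹ zeroMatrix m k)) * crossWeight₂₁ A Y))))
      ≡⟨ ∑⁴-product (allDigraphs k) (allDigraphs m) (allMatrices k m) (allMatrices m k) _ _ _ _ ⟩
    strongSum k * (etaSum m * (∑ (allMatrices k m) (λ X → χ (does (X ≟ᴹ zeroMatrix k m)) * crossWeight₁₂ A X)
                              * ∑ (allMatrices m k) (λ Y → χ (does (Y ≟ᴹ zeroMatrix m k)) * crossWeight₂₁ A Y)))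
      ≡⟨ cong₂ (λ s t → strongSum k * (etaSum m * (s * t)))
           (trans (∑-χ-zeroMatrix (crossWeight₁₂ A)) crossWeight₁₂-zero) (trans (∑-χ-zeroMatrix (crossWeight₂₁ A)) crossWeight₂₁-zero) ⟩
    strongSum k * (etaSum m * (1ℚ * 1ℚ))
      ≡⟨ cong (strongSum k *_) (*-identityʳ (etaSum m)) ⟩
    strongSum k * etaSum m ∎
    where
    F : Digraph n → ℚ
    F P = χ (does (Block? P full v A)) * (η P (full ∖ A) * weight P)
    term : ∀ D₁ D₂ X Y → F (assemble (D₁ , D₂ , X , Y))
      ≡ (χ (does (StrongOn? D₁ full)) * weight D₁) * ((η D₂ full * weight D₂)
          * ((χ (does (X ≟ᴹ zeroMatrix k m)) * crossWeight₁₂ A X) * (χ (does (Y ≟ᴹ zeroMatrix m k)) * crossWeight₂₁ A Y)))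
    term D₁ D₂ X Y = begin
      χ (does (Block? P full v A)) * (η P (full ∖ A) * weight P)
        ≡⟨ χ-cong₃ (does-⇔ block⇔ (Block? P full v A) (X ≟ᴹ zeroMatrix k m ×-dec (Y ≟ᴹ zeroMatrix m k ×-dec StrongOn? D₁ full)))
                    η-outside (weight-assemble A D₁ D₂ X Y) ⟩
      χ (does (X ≟ᴹ zeroMatrix k m ×-dec (Y ≟ᴹ zeroMatrix m k ×-dec StrongOn? D₁ full))) * (η D₂ full * (weight D₁ * weight D₂ * crossWeight₁₂ A X * crossWeight₂₁ A Y))
        ≡⟨ cong (_* (η D₂ full * (weight D₁ * weight D₂ * crossWeight₁₂ A X * crossWeight₂₁ A Y)))
             (trans (χ-×-dec (X ≟ᴹ zeroMatrix k m) (Y ≟ᴹ zeroMatrix m k ×-dec StrongOn? D₁ full))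
                    (cong (χ x₀ *_) (χ-×-dec (Y ≟ᴹ zeroMatrix m k) (StrongOn? D₁ full)))) ⟩
      (χ x₀ * (χ y₀ * χ s₁)) * (η D₂ full * (weight D₁ * weight D₂ * crossWeight₁₂ A X * crossWeight₂₁ A Y))
        ≡⟨ solve 8 (λ ix iy is e g₁ g₂ wx wy → (ix :* (iy :* is)) :* (e :* (g₁ :* g₂ :* wx :* wy)) := (is :* g₁) :* ((e :* g₂) :* ((ix :* wx) :* (iy :* wy)))) refl
             (χ x₀) (χ y₀) (χ s₁) (η D₂ full) (weight D₁) (weight D₂) (crossWeight₁₂ A X) (crossWeight₂₁ A Y) ⟩
      (χ s₁ * weight D₁) * ((η D₂ full * weight D₂) * ((χ x₀ * crossWeight₁₂ A X) * (χ y₀ * crossWeight₂₁ A Y))) ∎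
      where
      open +-*-Solver
      open Assembled (D₁ , D₂ , X , Y) using (P; η-outside; StrongOn-inside; Detached⇔no-edges-across)
      x₀ = does (X ≟ᴹ zeroMatrix k m)
      y₀ = does (Y ≟ᴹ zeroMatrix m k)
      s₁ = does (StrongOn? D₁ full)
      block⇔ : Block P full v A ⇔ (X ≡ zeroMatrix k m × (Y ≡ zeroMatrix m k × StrongOn D₁ full))
      block⇔ = mk⇔
        (λ (_ , _ , det , sc) → let (x≡0 , y≡0) = Equivalence.to Detached⇔no-edges-across det in x≡0 , y≡0 , Equivalence.to StrongOn-inside sc)
        (λ (x≡0 , y≡0 , sc) → (λ i _ → full∋ i) , av , Equivalence.from Detached⇔no-edges-across (x≡0 , y≡0) , Equivalence.from StrongOn-inside sc)

-- The two recursions for etaSum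
C2-double : ∀ d → (suc d C 2) ℕ.* 2 ≡ suc d ℕ.* d
C2-double zero = refl
C2-double (suc d) = begin
  (suc (suc d) C 2) ℕ.* 2                 ≡⟨ cong (ℕ._* 2) (sym (nCk+nC[k+1]≡[n+1]C[k+1] (suc d) 1)) ⟩
  (suc d C 1 ℕ.+ suc d C 2) ℕ.* 2         ≡⟨ cong (λ z → (z ℕ.+ suc d C 2) ℕ.* 2) (nC1≡n (suc d)) ⟩
  (suc d ℕ.+ suc d C 2) ℕ.* 2             ≡⟨ ℕₚ.*-distribʳ-+ 2 (suc d) (suc d C 2) ⟩
  suc d ℕ.* 2 ℕ.+ (suc d C 2) ℕ.* 2       ≡⟨ cong (suc d ℕ.* 2 ℕ.+_) (C2-double d) ⟩
  suc d ℕ.* 2 ℕ.+ suc d ℕ.* d             ≡⟨ solve 1 (λ d → (con 1 :+ d) :* con 2 :+ (con 1 :+ d) :* d := (con 2 :+ d) :* (con 1 :+ d)) refl d ⟩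
  suc (suc d) ℕ.* suc d                   ∎
  where open ℕ-Solver

-- The (1+y)-exponent of the definition of η splits into the edges inside the last n − k vertices
-- and those between the first k and the last n − k.
halved-exponent : ∀ n k → 1 ≤ k → k ≤ n → ((n ∸ k) ℕ.* (n ℕ.+ k ∸ 1)) / 2 ≡ (n ∸ k) C 2 ℕ.+ k ℕ.* (n ∸ k)
halved-exponent n (suc k₀) (s≤s _) le = begin
  ((n ∸ suc k₀) ℕ.* (n ℕ.+ suc k₀ ∸ 1)) / 2       ≡⟨ cong (λ z → ((z ∸ suc k₀) ℕ.* (z ℕ.+ suc k₀ ∸ 1)) / 2) (sym (ℕₚ.m+[n∸m]≡n le)) ⟩
  ((suc k₀ ℕ.+ d ∸ suc k₀) ℕ.* (suc k₀ ℕ.+ d ℕ.+ suc k₀ ∸ 1)) / 2 ≡⟨ cong (λ a → (a ℕ.* (k₀ ℕ.+ d ℕ.+ suc k₀)) / 2) (ℕₚ.m+n∸m≡n (suc k₀) d) ⟩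
  (d ℕ.* (k₀ ℕ.+ d ℕ.+ suc k₀)) / 2                ≡⟨ cong (_/ 2) (doubled d) ⟩
  ((d C 2 ℕ.+ suc k₀ ℕ.* d) ℕ.* 2) / 2             ≡⟨ m*n/n≡m (d C 2 ℕ.+ suc k₀ ℕ.* d) 2 ⟩
  d C 2 ℕ.+ suc k₀ ℕ.* d                             ∎
  where
  open ℕ-Solver
  d = n ∸ suc k₀
  doubled : ∀ d → d ℕ.* (k₀ ℕ.+ d ℕ.+ suc k₀) ≡ (d C 2 ℕ.+ suc k₀ ℕ.* d) ℕ.* 2
  doubled zero = sym (cong (ℕ._* 2) (ℕₚ.*-zeroʳ k₀))
  doubled (suc d₀) = begin
    suc d₀ ℕ.* (k₀ ℕ.+ suc d₀ ℕ.+ suc k₀)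
      ≡⟨ solve 2 (λ k d → (con 1 :+ d) :* (k :+ (con 1 :+ d) :+ (con 1 :+ k)) := (con 1 :+ d) :* d :+ (con 1 :+ k) :* (con 1 :+ d) :* con 2) refl k₀ d₀ ⟩
    suc d₀ ℕ.* d₀ ℕ.+ (suc k₀ ℕ.* suc d₀) ℕ.* 2       ≡⟨ cong (ℕ._+ (suc k₀ ℕ.* suc d₀) ℕ.* 2) (sym (C2-double d₀)) ⟩
    (suc d₀ C 2) ℕ.* 2 ℕ.+ (suc k₀ ℕ.* suc d₀) ℕ.* 2   ≡⟨ sym (ℕₚ.*-distribʳ-+ 2 (suc d₀ C 2) (suc k₀ ℕ.* suc d₀)) ⟩
    (suc d₀ C 2 ℕ.+ suc k₀ ℕ.* suc d₀) ℕ.* 2          ∎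

module Recursions (u y : ℚ) (nz : 1ℚ + y ≢ 0ℚ) where
  open Weights u y

  q : ℚ
  q = qval u y nz

  β≡qα : β ≡ q * α
  β≡qα = sym (trans (*-assoc β _ α) (trans (cong (β *_) (*-inverseˡ α {{ℚ.≢-nonZero nz}})) (*-identityʳ β)))

  -- term n j collects the in-closed sets A of size j in Σ_D Σ_A η_D(A) weight(D).
  term : ℕ → ℕ → ℚ
  term n j = (etaSum j * ∑ (allDigraphs (n ∸ j)) weight) * (α ^ (j ℕ.* (n ∸ j)) * qbinom q n j)

  ∑-term≡0 : ∀ n → 1 ≤ n → ∑ (interval 0 (suc n)) (term n) ≡ 0ℚ
  ∑-term≡0 n@(suc _) _ = begin
    ∑ (interval 0 (suc n)) (term n)
      ≡⟨ ∑-cong (interval 0 (suc n)) (λ j → cong ((etaSum j * ∑ (allDigraphs (n ∸ j)) weight) *_) (sym (∑-crossFactor q β≡qα n j))) ⟩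
    ∑ (interval 0 (suc n)) (λ j → (etaSum j * ∑ (allDigraphs (n ∸ j)) weight) * ∑ (allVecs n) (λ A → χ (count A ≡ᵇ j) * crossFactor A))
      ≡⟨ sym (∑-by-size n (λ j → etaSum j * ∑ (allDigraphs (n ∸ j)) weight) crossFactor) ⟩
    ∑ (allVecs n) (λ A → (etaSum (count A) * ∑ (allDigraphs (n ∸ count A)) weight) * crossFactor A)
      ≡⟨ ∑-cong (allVecs n) (λ A → trans (*-assoc (etaSum (count A)) _ _) (cong (λ z → etaSum (count A) * (∑ (allDigraphs z) weight * crossFactor A)) (sym (count∁≡ A)))) ⟩
    ∑ (allVecs n) (λ A → etaSum (count A) * (∑ (allDigraphs (count∁ A)) weight * crossFactor A))
      ≡⟨ ∑-cong (allVecs n) (λ A → sym (Factorisation.∑-InClosed-factor u y A)) ⟩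
    ∑ (allVecs n) (λ A → ∑ (allDigraphs n) (λ D → χ (does (InClosed? D A)) * (η D A * weight D)))
      ≡⟨ ∑-swap (allVecs n) (allDigraphs n) _ ⟩
    ∑ (allDigraphs n) (λ D → ∑ (allVecs n) (λ A → χ (does (InClosed? D A)) * (η D A * weight D)))
      ≡⟨ ∑-cong (allDigraphs n) (λ D → trans (∑-cong (allVecs n) (λ A → sym (*-assoc (χ (does (InClosed? D A))) (η D A) (weight D))))
                                            (sym (*-distribʳ-∑ (weight D) (allVecs n) (λ A → χ (does (InClosed? D A)) * η D A)))) ⟩
    ∑ (allDigraphs n) (λ D → ∑ (allVecs n) (λ A → χ (does (InClosed? D A)) * η D A) * weight D)
      ≡⟨ ∑-cong (allDigraphs n) (λ D → trans (cong (_* weight D) (∑-η-InClosed≡0 D zero)) (*-zeroˡ (weight D))) ⟩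
    ∑ (allDigraphs n) (λ _ → 0ℚ)
      ≡⟨ ∑-zero (allDigraphs n) ⟩
    0ℚ ∎

  -- The terms j = 0 and j = n of the vanishing sum are −(all digraphs) and etaSum n.
  etaSum-recursion : ∀ n′ → etaSum (suc n′) ≡ ∑ (allDigraphs (suc n′)) weight - ∑ (interval 1 n′) (term (suc n′))
  etaSum-recursion n′ = begin
    etaSum n                                 ≡⟨ solve 3 (λ T Σ′ H → H := (T :- Σ′) :+ ((:- T) :+ (Σ′ :+ H))) refl T Σ′ (etaSum n) ⟩
    (T - Σ′) + (- T + (Σ′ + etaSum n))       ≡⟨ cong (λ z → (T - Σ′) + z) (trans (cong₂ (λ a b → a + (Σ′ + b)) first (sym last)) (trans (cong (term n 0 +_) (sym (∑-interval-last 1 n′ (term n)))) (∑-term≡0 n (s≤s z≤n)))) ⟩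
    (T - Σ′) + 0ℚ                            ≡⟨ +-identityʳ _ ⟩
    T - Σ′                                   ∎
    where
    open +-*-Solver
    n = suc n′
    T = ∑ (allDigraphs n) weight
    Σ′ = ∑ (interval 1 n′) (term n)
    first : - T ≡ term n 0
    first = solve 1 (λ t → :- t := (con (- 1ℚ) :* t) :* (con 1ℚ :* con 1ℚ)) refl T
    last : term n n ≡ etaSum n
    last = begin
      (etaSum n * ∑ (allDigraphs (n ∸ n)) weight) * (α ^ (n ℕ.* (n ∸ n)) * qbinom q n n)
        ≡⟨ cong₂ (λ a b → (etaSum n * ∑ (allDigraphs a) weight) * (α ^ (n ℕ.* a) * b)) (ℕₚ.n∸n≡0 n) (qbinom-diagonal q n) ⟩
      (etaSum n * 1ℚ) * (α ^ (n ℕ.* 0) * 1ℚ)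
        ≡⟨ cong (λ a → (etaSum n * 1ℚ) * (α ^ a * 1ℚ)) (ℕₚ.*-zeroʳ n) ⟩
      (etaSum n * 1ℚ) * (1ℚ * 1ℚ)
        ≡⟨ solve 1 (λ h → (h :* con 1ℚ) :* (con 1ℚ :* con 1ℚ) := h) refl (etaSum n) ⟩
      etaSum n ∎

  etaF≡etaSum : ∀ f k → 1 ≤ k → k ≤ f → etaF u y nz f k ≡ etaSum k
  etaF≡etaSum (suc f) k@(suc k′) _ (s≤s k≤f) = begin
    etaF u y nz (suc f) k
      ≡⟨ cong₂ _-_ (sym (∑-weight k)) (trans (Σ[⋯]≡∑ 1 k′ _) (∑-cong-∈ (interval 1 k′) summand)) ⟩
    ∑ (allDigraphs k) weight - ∑ (interval 1 k′) (term k)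
      ≡⟨ sym (etaSum-recursion k′) ⟩
    etaSum k ∎
    where
    open +-*-Solver
    summand : ∀ {j} → j ∈ interval 1 k′
      → qbinom q k j * (β ^ ((k ∸ j) C 2)) * (α ^ (((k ∸ j) ℕ.* (k ℕ.+ j ∸ 1)) / 2)) * etaF u y nz f j ≡ term k j
    summand {j} j∈ = begin
      qbinom q k j * β ^ ((k ∸ j) C 2) * α ^ (((k ∸ j) ℕ.* (k ℕ.+ j ∸ 1)) / 2) * etaF u y nz f j
        ≡⟨ cong₂ (λ e h → qbinom q k j * β ^ ((k ∸ j) C 2) * e * h)
             (trans (cong (α ^_) (halved-exponent k j 1≤j j≤k)) (^-+ α ((k ∸ j) C 2) (j ℕ.* (k ∸ j))))
             (etaF≡etaSum f j 1≤j (ℕₚ.≤-trans (ℕₚ.≤-pred j<k) k≤f)) ⟩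
      qbinom q k j * β ^ ((k ∸ j) C 2) * (α ^ ((k ∸ j) C 2) * α ^ (j ℕ.* (k ∸ j))) * etaSum j
        ≡⟨ solve 5 (λ Q B A₁ A₂ h → Q :* B :* (A₁ :* A₂) :* h := (h :* (A₁ :* B)) :* (A₂ :* Q)) refl
             (qbinom q k j) (β ^ ((k ∸ j) C 2)) (α ^ ((k ∸ j) C 2)) (α ^ (j ℕ.* (k ∸ j))) (etaSum j) ⟩
      (etaSum j * (α ^ ((k ∸ j) C 2) * β ^ ((k ∸ j) C 2))) * (α ^ (j ℕ.* (k ∸ j)) * qbinom q k j)
        ≡⟨ cong (λ t → (etaSum j * t) * (α ^ (j ℕ.* (k ∸ j)) * qbinom q k j)) (sym (∑-weight (k ∸ j))) ⟩
      term k j ∎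
      where
      1≤j : 1 ≤ j
      1≤j = proj₁ (∈-interval⁻ 1 k′ j∈)
      j<k : j < k
      j<k = proj₂ (∈-interval⁻ 1 k′ j∈)
      j≤k : j ≤ k
      j≤k = ℕₚ.<⇒≤ j<k

  eta≡etaSum : ∀ k → 1 ≤ k → eta u y nz k ≡ etaSum k
  eta≡etaSum k 1≤k = etaF≡etaSum k k 1≤k ℕₚ.≤-refl

  -- Peel off the detached strongly connected block containing vertex 0; its size is 1 + j.
  etaSum-block-recursion : ∀ n′ → etaSum (suc n′)
    ≡ - ∑ (interval 0 (suc n′)) (λ j → strongSum (suc j) * etaSum (n′ ∸ j) * ℕtoℚ (n′ C j))
  etaSum-block-recursion n′ = begin
    etaSum n
      ≡⟨ ∑-cong (allDigraphs n) (λ D → cong (_* weight D) (η-rec D full {zero} refl)) ⟩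
    ∑ (allDigraphs n) (λ D → (- ∑ (allVecs n) (λ T → χ (does (Block? D full zero T)) * η D (full ∖ T))) * weight D)
      ≡⟨ ∑-cong (allDigraphs n) (λ D → trans (sym (neg-distribˡ-* (∑ (allVecs n) (B D)) (weight D)))
           (cong -_ (trans (*-distribʳ-∑ (weight D) (allVecs n) (B D))
             (∑-cong (allVecs n) λ T → *-assoc (χ (does (Block? D full zero T))) (η D (full ∖ T)) (weight D))))) ⟩
    ∑ (allDigraphs n) (λ D → - ∑ (allVecs n) (F D))
      ≡⟨ ∑-neg (allDigraphs n) _ ⟩
    - ∑ (allDigraphs n) (λ D → ∑ (allVecs n) (F D))
      ≡⟨ cong -_ (∑-swap (allDigraphs n) (allVecs n) F) ⟩
    - ∑ (allVecs n) (λ T → ∑ (allDigraphs n) (λ D → F D T))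
      ≡⟨ cong -_ (∑-allVecs-suc n′ _) ⟩
    - (∑ (allVecs n′) (λ T → ∑ (allDigraphs n) (λ D → F D (false ∷ T))) + ∑ (allVecs n′) (λ T → ∑ (allDigraphs n) (λ D → F D (true ∷ T))))
      ≡⟨ cong₂ (λ a b → - (a + b)) (trans (∑-cong (allVecs n′) λ T → trans (∑-cong (allDigraphs n) λ D →
                 χ-zero (Block? D full zero (false ∷ T)) _ λ where (_ , () , _)) (∑-zero (allDigraphs n))) (∑-zero (allVecs n′)))
           (∑-cong (allVecs n′) λ T → Factorisation.∑-Block-factor u y (true ∷ T) zero refl) ⟩
    - (0ℚ + ∑ (allVecs n′) (λ T → strongSum (suc (count T)) * etaSum (count∁ T)))
      ≡⟨ cong -_ (trans (+-identityˡ _) (∑-cong (allVecs n′) λ T →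
           trans (cong (λ z → strongSum (suc (count T)) * etaSum z) (count∁≡ T)) (sym (*-identityʳ _)))) ⟩
    - ∑ (allVecs n′) (λ T → g (count T) * 1ℚ)
      ≡⟨ cong -_ (∑-by-size n′ g (λ _ → 1ℚ)) ⟩
    - ∑ (interval 0 (suc n′)) (λ j → g j * ∑ (allVecs n′) (λ A → χ (count A ≡ᵇ j) * 1ℚ))
      ≡⟨ cong -_ (∑-cong (interval 0 (suc n′)) λ j → cong (g j *_) (trans (∑-cong (allVecs n′) λ A → *-identityʳ _) (∑-χ-count≡C n′ j))) ⟩
    - ∑ (interval 0 (suc n′)) (λ j → g j * ℕtoℚ (n′ C j)) ∎
    where
    n = suc n′
    B : Digraph n → Mask n → ℚ
    B D T = χ (does (Block? D full zero T)) * η D (full ∖ T)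
    F : Digraph n → Mask n → ℚ
    F D T = χ (does (Block? D full zero T)) * (η D (full ∖ T) * weight D)
    g : ℕ → ℚ
    g j = strongSum (suc j) * etaSum (n′ ∸ j)

  strongSum-recursion : ∀ n′ → strongSum (suc n′)
    ≡ etaSum (suc n′) + ∑ (interval 0 n′) (λ j → strongSum (suc j) * etaSum (n′ ∸ j) * ℕtoℚ (n′ C j))
  strongSum-recursion n′ = begin
    strongSum n                        ≡⟨ solve 2 (λ Σ′ S → S := :- (Σ′ :+ S :* con (- 1ℚ) :* con 1ℚ) :+ Σ′) refl Σ′ (strongSum n) ⟩
    - (Σ′ + last) + Σ′                 ≡⟨ cong (λ z → - (Σ′ + z) + Σ′) (sym top) ⟩
    - (Σ′ + f n′) + Σ′                 ≡⟨ cong (λ z → - z + Σ′) (sym (∑-interval-last 0 n′ f)) ⟩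
    - ∑ (interval 0 (suc n′)) f + Σ′   ≡⟨ cong (_+ Σ′) (sym (etaSum-block-recursion n′)) ⟩
    etaSum n + Σ′                      ∎
    where
    open +-*-Solver
    n = suc n′
    f : ℕ → ℚ
    f j = strongSum (suc j) * etaSum (n′ ∸ j) * ℕtoℚ (n′ C j)
    Σ′ = ∑ (interval 0 n′) f
    last = strongSum n * - 1ℚ * 1ℚ
    top : f n′ ≡ last
    top = cong₂ (λ a b → strongSum n * etaSum a * ℕtoℚ b) (ℕₚ.n∸n≡0 n′) (nCn≡1 n′)

corollary3p7 : (u y : ℚ) (nz : 1ℚ + y ≢ 0ℚ)
    → (SC : (n : ℕ) → List (Digraph n))
    → ((n : ℕ) → Unique (SC n))
    → ((n : ℕ) (D : Digraph n) → (D ∈ SC n) ⇔ (Loopless D × StronglyConnected D))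
    → (n : ℕ) → n ≥ 1
    → weightSum u y (SC n)
      ≡ eta u y nz n
        + Σ[ 1 ⋯ n ∸ 1 ] (λ k →
            ℕtoℚ ((n ∸ 1) C (k ∸ 1)) * weightSum u y (SC k) * eta u y nz (n ∸ k))
corollary3p7 u y nz SC uSC mem n@(suc n′) _ = begin
  weightSum u y (SC n)                     ≡⟨ s≡strongSum n ⟩
  strongSum n                              ≡⟨ strongSum-recursion n′ ⟩
  etaSum n + ∑ (interval 0 n′) g           ≡⟨ cong₂ _+_ (sym (eta≡etaSum n (s≤s z≤n))) (sym reindex) ⟩
  eta u y nz n + Σ[ 1 ⋯ n ∸ 1 ] f          ∎
  where
  open Weights u y
  open Recursions u y nz
  s≡strongSum : ∀ k → weightSum u y (SC k) ≡ strongSum k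
  s≡strongSum k = weightSum≡∑-StrongOn k (SC k) (uSC k) (mem k)
  f g : ℕ → ℚ
  f k = ℕtoℚ ((n ∸ 1) C (k ∸ 1)) * weightSum u y (SC k) * eta u y nz (n ∸ k)
  g j = strongSum (suc j) * etaSum (n′ ∸ j) * ℕtoℚ (n′ C j)
  reindex : Σ[ 1 ⋯ n ∸ 1 ] f ≡ ∑ (interval 0 n′) g
  reindex = trans (Σ[⋯]≡∑ 1 n′ f) (trans (∑-interval-suc 0 n′ f) (∑-cong-∈ (interval 0 n′) λ {j} j∈ →
    trans (cong₂ (λ s e → ℕtoℚ (n′ C j) * s * e) (s≡strongSum (suc j)) (eta≡etaSum (n′ ∸ j) (ℕₚ.m<n⇒0<n∸m (proj₂ (∈-interval⁻ 0 n′ j∈)))))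
          (solve 3 (λ c s h → c :* s :* h := s :* h :* c) refl (ℕtoℚ (n′ C j)) (strongSum (suc j)) (etaSum (n′ ∸ j)))))
    where open +-*-Solver
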